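{- Let $\mathcal V:=\{(x,y)\in[0,1]^2:\ \max\{(1-3x)/2,\,2x-1\}\le y\le \max\{1-x,x\}\}$. For each integer $Q\ge 3$ let $\mathscr D_Q$ be the set of pairs $(q_1,q_2)$ of denominators of consecutive elements $a_1/q_1<a_2/q_2$ of $\mathfrak{SF}_Q$ (fractions in lowest terms), and let $\mathscr D:=\bigcup_{Q\ge 3} Q^{ -1}\mathscr D_Q\subseteq\mathbb R^2$. Then $\mathscr D$ is dense in $\mathcal V$: $\mathscr D\subseteq \mathcal V$ and the closure of $\mathscr D$ contains $\mathcal V$.
   Context: For a reduced fraction $a/q\in\mathbb Q\cap(0,1]$ with $q\ge 2$, let $\bar a$ denote the multiplicative inverse of $a$ modulo $q$ in $[1,q)$, and set $h(a/q):=q+a+\bar a$; for $a/q=1/1$ set $h(1/1):=3$. The set of $\mathrm{SL}(2,\mathbb N)$-saturated Farey fractions of level $Q\ge3$ is $\mathfrak{SF}_Q:=\{a/q\in\mathbb Q\cap(0,1]: h(a/q)\le Q\}$, and "consecutive elements" refers to neighbors when $\mathfrak{SF}_Q$ is listed in increasing order.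
   Formalization: The density of $\mathscr D$ in $\mathcal V$ is asserted only at points of $\mathcal V$ with rational coordinates, which are approximated to within every rational distance. -}

module Defs where

open import Data.Nat using (ℕ; zero; suc; _+_; _*_; _≤_; _<_)
open import Data.Nat.Coprimality using (Coprime)
open import Data.Integer using (+_)
open import Data.Rational as ℚ using (ℚ; 0ℚ; 1ℚ; _-_; _⊔_; ∣_∣)
open import Data.Product using (Σ; ∃; _×_; _,_)
open import Data.Sum using (_⊎_)
open import Relation.Binary.PropositionalEquality using (_≡_)

ModInv : ℕ → ℕ → ℕ → Set
ModInv q a b = (1 ≤ b) × (b < q) × ∃ λ k → a * b ≡ 1 + k * q

-- h(a/q) ≤ Q for the reduced fraction a/q ∈ (0,1].
-- q = 1 (so a = 1): h = 3.  q ≥ 2: h = q + a + ā, ā the (unique) inverse.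
HeightLe : ℕ → ℕ → ℕ → Set
HeightLe Q a q = ((q ≡ 1) × (3 ≤ Q))
               ⊎ ((2 ≤ q) × ∃ λ b → ModInv q a b × (q + a + b ≤ Q))

InSF : ℕ → ℕ → ℕ → Set
InSF Q a q = (1 ≤ a) × (a ≤ q) × Coprime a q × HeightLe Q a q

Consecutive : ℕ → ℕ → ℕ → ℕ → ℕ → Set
Consecutive Q a₁ q₁ a₂ q₂ =
  InSF Q a₁ q₁ × InSF Q a₂ q₂ × (a₁ * q₂ < a₂ * q₁)
  × (∀ a q → InSF Q a q → a₁ * q < a * q₁ → a * q₂ < a₂ * q → Data.Empty.⊥)
  where import Data.Empty

InDQ : ℕ → ℕ → ℕ → Set
InDQ Q q₁ q₂ = ∃ λ a₁ → ∃ λ a₂ → Consecutive Q a₁ q₁ a₂ q₂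

-- n / m as a rational (only used with m ≥ 3)
_/ℕ_ : ℕ → ℕ → ℚ
n /ℕ zero = 0ℚ
n /ℕ suc m = (+ n) ℚ./ suc m

InV : ℚ → ℚ → Set
InV x y = (0ℚ ℚ.≤ x) × (x ℚ.≤ 1ℚ) × (0ℚ ℚ.≤ y) × (y ℚ.≤ 1ℚ)
        × (((1ℚ - (3ℚ ℚ.* x)) ℚ.* ½) ⊔ ((2ℚ ℚ.* x) - 1ℚ) ℚ.≤ y)
        × (y ℚ.≤ (1ℚ - x) ⊔ x)
  where
  2ℚ 3ℚ ½ : ℚ
  2ℚ = (+ 2) ℚ./ 1
  3ℚ = (+ 3) ℚ./ 1
  ½ = (+ 1) ℚ./ 2

{-# OPTIONS --safe #-}

-- Consecutive elements a₁/q₁ < a₂/q₂ of 𝔖𝔉_Q are Farey neighbours, a₂q₁ = 1 + a₁q₂: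
-- otherwise the Farey neighbour k/b of the fraction with the larger denominator, built
-- from its modular inverse b, has no larger height and lies strictly between them.
-- For neighbours the inverses are explicit (q₁ mod q₂ for a₂, −q₂ mod q₁ for a₁), and
-- every fraction strictly between them has height at least 2q₁ + q₂ + a₁ + a₂, the
-- height of the mediant. The heights of a₁/q₁, a₂/q₂ and of the mediant then give
-- exactly the inequalities defining 𝒱.
--
-- Conversely, neighbours are consecutive in 𝔖𝔉_Q as soon as a few linear inequalities
-- in q₁, q₂, a₁, a₂, Q hold. A rational point of 𝒱, pushed slightly into the interior,
-- is written as (X/C, Y/C); for a slope p/r satisfying the limiting inequalities
-- strictly, the pair with matrix (r r′; p p′)·(1 dm; 0 1)·(s t; i j), where
-- (i, j) = (X, Y)/d is primitive, is consecutive in 𝔖𝔉_{mrC} for large m, and its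
-- denominators divided by mrC are within 1/(rC) of X/C and Y/C.

module Submission where

open import Defs
open import Data.Nat hiding (_⊔_; ∣_-_∣)
open import Data.Nat.Properties
open import Data.Nat.DivMod
open import Data.Nat.Divisibility using (_∣_; ∣1⇒≡1; ∣m+n∣m⇒∣n; ∣n⇒∣m*n; n∣m*n; ∣⇒≤)
open import Data.Nat.Coprimality using (Coprime; coprime-divisor; coprime-Bézout; coprime-/gcd; 1-coprimeTo)
  renaming (sym to coprime-sym)
open import Data.Nat.GCD using (gcd; gcd[m,n]∣m; gcd[m,n]∣n; gcd[m,n]≢0; module Bézout)
open import Data.Nat.Tactic.RingSolver using (solve)
open import Data.Integer as ℤ using (-[1+_])
import Data.Integer.Properties as ℤ
open import Data.Rational as ℚ using (ℚ; mkℚ; 0ℚ; 1ℚ; _-_; ∣_∣; _⊔_; toℚᵘ; *≤*; *<*)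
import Data.Rational.Properties as ℚ
open import Data.Rational.Unnormalised as ℚᵘ using (mkℚᵘ; *≡*)
import Data.Rational.Unnormalised.Properties as ℚᵘ
open import Data.List.Base using (_∷_; [])
open import Data.Product
open import Data.Sum
open import Data.Empty
open import Function.Base using (_$_)
open import Function.Bundles using (_⇔_; mk⇔; Equivalence)
open import Level using (0ℓ)
open import Relation.Nullary using (yes; no)
open import Relation.Nullary.Decidable using (dec⇒maybe)
open import Relation.Binary.PropositionalEquality
open import Relation.Binary.Definitions using (tri<; tri≈; tri>)
open import Tactic.RingSolver using () renaming (solve to solve-ring)
open import Tactic.RingSolver.Core.AlmostCommutativeRing using (AlmostCommutativeRing; fromCommutativeRing)

-- Modular inverses

congruent-1 : ∀ {A q} m k → 2 ≤ q → A + m * q ≡ 1 + k * q → ∃ λ K → A ≡ 1 + K * q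
congruent-1 {A} {q@(suc (suc _))} m k (s≤s (s≤s _)) eq = A / q , (begin
  A                 ≡⟨ m≡m%n+[m/n]*n A q ⟩
  A % q + A / q * q ≡⟨ cong (_+ A / q * q) A%q≡1 ⟩
  1 + A / q * q     ∎)
  where
  open ≡-Reasoning
  A%q≡1 : A % q ≡ 1
  A%q≡1 = begin
    A % q           ≡⟨ [m+kn]%n≡m%n A m q ⟨
    (A + m * q) % q ≡⟨ cong (_% q) eq ⟩
    (1 + k * q) % q ≡⟨ [m+kn]%n≡m%n 1 k q ⟩
    1 % q           ≡⟨⟩
    1               ∎

*≢1+* : ∀ {q} m k → 2 ≤ q → m * q ≢ 1 + k * q
*≢1+* m k 2≤q eq with congruent-1 {0} m k 2≤q eq
... | _ , ()

*-split-mod : ∀ a c q .{{_ : NonZero q}} → a * c ≡ a * (c % q) + a * (c / q) * q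
*-split-mod a c q = begin
  a * c                         ≡⟨ cong (a *_) (m≡m%n+[m/n]*n c q) ⟩
  a * (c % q + c / q * q)       ≡⟨ *-distribˡ-+ a (c % q) (c / q * q) ⟩
  a * (c % q) + a * (c / q * q) ≡⟨ cong (a * (c % q) +_) (*-assoc a (c / q) q) ⟨
  a * (c % q) + a * (c / q) * q ∎
  where open ≡-Reasoning

modInv-% : ∀ {q} .{{_ : NonZero q}} a c k → 2 ≤ q → a * c ≡ 1 + k * q → ModInv q a (c % q)
modInv-% {q} a c k 2≤q eq =
  n≢0⇒n>0 c%q≢0 , m%n<n c q , congruent-1 (a * (c / q)) k 2≤q (trans (sym (*-split-mod a c q)) eq)
  where
  c%q≢0 : c % q ≢ 0
  c%q≢0 c%q≡0 = *≢1+* (a * (c / q)) k 2≤q (begin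
    a * (c / q) * q                 ≡⟨ cong (_+ a * (c / q) * q) (*-zeroʳ a) ⟨
    a * 0 + a * (c / q) * q         ≡⟨ cong (λ b → a * b + a * (c / q) * q) c%q≡0 ⟨
    a * (c % q) + a * (c / q) * q   ≡⟨ *-split-mod a c q ⟨
    a * c                           ≡⟨ eq ⟩
    1 + k * q                       ∎)
    where open ≡-Reasoning

modInv-∸% : ∀ {q} .{{_ : NonZero q}} a c k → 2 ≤ q → a * c + 1 ≡ k * q → ModInv q a (q ∸ c % q)
modInv-∸% {q} a c k 2≤q eq =
  m<n⇒0<n∸m (m%n<n c q) , ∸-monoʳ-< (n≢0⇒n>0 c%q≢0) (<⇒≤ (m%n<n c q)) ,
  congruent-1 k (a + a * (c / q)) 2≤q
    (congruence (c % q) (c / q) (q ∸ c % q) (m+[n∸m]≡n (<⇒≤ (m%n<n c q))) (*-split-mod a c q))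
  where
  open ≡-Reasoning
  congruence : ∀ s t b → s + b ≡ q → a * c ≡ a * s + a * t * q → a * b + k * q ≡ 1 + (a + a * t) * q
  congruence s t b s+b≡q split = begin
    a * b + k * q                   ≡⟨ cong (a * b +_) eq ⟨
    a * b + (a * c + 1)             ≡⟨ cong (λ x → a * b + (x + 1)) split ⟩
    a * b + (a * s + a * t * q + 1) ≡⟨ solve (a ∷ b ∷ s ∷ t ∷ q ∷ []) ⟩
    1 + (a * (s + b) + a * t * q)   ≡⟨ cong (λ x → 1 + (a * x + a * t * q)) s+b≡q ⟩
    1 + (a * q + a * t * q)         ≡⟨ solve (a ∷ t ∷ q ∷ []) ⟩
    1 + (a + a * t) * q             ∎
  c%q≢0 : c % q ≢ 0
  c%q≢0 c%q≡0 = *≢1+* k (a * (c / q)) 2≤q (begin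
    k * q                           ≡⟨ eq ⟨
    a * c + 1                       ≡⟨ cong (_+ 1) (*-split-mod a c q) ⟩
    a * (c % q) + a * (c / q) * q + 1 ≡⟨ cong (λ b → a * b + a * (c / q) * q + 1) c%q≡0 ⟩
    a * 0 + a * (c / q) * q + 1     ≡⟨ cong (λ x → x + a * (c / q) * q + 1) (*-zeroʳ a) ⟩
    a * (c / q) * q + 1             ≡⟨ +-comm _ 1 ⟩
    1 + a * (c / q) * q             ∎)

modInv-unique : ∀ {q a b b′} → ModInv q a b → ModInv q a b′ → b ≡ b′
modInv-unique {q} {a} {b} {b′} (_ , b<q , k , eq) (_ , b′<q , k′ , eq′) = begin
  b                         ≡⟨ m<n⇒m%n≡m b<q ⟨
  b % q                     ≡⟨ [m+kn]%n≡m%n b (b * k′) q ⟨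
  (b + b * k′ * q) % q      ≡⟨ cong (_% q) same ⟩
  (b′ + b′ * k * q) % q     ≡⟨ [m+kn]%n≡m%n b′ (b′ * k) q ⟩
  b′ % q                    ≡⟨ m<n⇒m%n≡m b′<q ⟩
  b′                        ∎
  where
  open ≡-Reasoning
  instance
    q≢0 : NonZero q
    q≢0 = >-nonZero (≤-<-trans z≤n b<q)
  same : b + b * k′ * q ≡ b′ + b′ * k * q
  same = begin
    b + b * k′ * q  ≡⟨ solve (b ∷ k′ ∷ q ∷ []) ⟩
    b * (1 + k′ * q) ≡⟨ cong (b *_) eq′ ⟨
    b * (a * b′)    ≡⟨ solve (a ∷ b ∷ b′ ∷ []) ⟩
    b′ * (a * b)    ≡⟨ cong (b′ *_) eq ⟩
    b′ * (1 + k * q) ≡⟨ solve (b′ ∷ k ∷ q ∷ []) ⟩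
    b′ + b′ * k * q ∎

unimodular⇒coprime : ∀ {a q} x y → x * a ≡ 1 + y * q → Coprime a q
unimodular⇒coprime {a} {q} x y eq {d} (d∣a , d∣q) =
  ∣1⇒≡1 (∣m+n∣m⇒∣n (subst (d ∣_) (trans eq (+-comm 1 (y * q))) (∣n⇒∣m*n x d∣a)) (∣n⇒∣m*n y d∣q))

-- Farey neighbours

mediant-decomposition : ∀ {c₁ d₁ c₂ d₂ c d u v} → c₂ * d₁ ≡ 1 + c₁ * d₂ →
                        c₁ * d + v ≡ c * d₁ → c * d₂ + u ≡ c₂ * d →
                        d₁ * u + d₂ * v ≡ d × c₁ * u + c₂ * v ≡ c
mediant-decomposition {c₁} {d₁} {c₂} {d₂} {c} {d} {u} {v} nb hv hu = denominators , numerators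
  where
  open ≡-Reasoning
  denominators : d₁ * u + d₂ * v ≡ d
  denominators = +-cancelʳ-≡ (c * d₁ * d₂ + c₁ * d * d₂) _ _ (begin
    d₁ * u + d₂ * v + (c * d₁ * d₂ + c₁ * d * d₂) ≡⟨ solve (c₁ ∷ d₁ ∷ d₂ ∷ c ∷ d ∷ u ∷ v ∷ []) ⟩
    d₁ * (c * d₂ + u) + d₂ * (c₁ * d + v)         ≡⟨ cong₂ (λ x y → d₁ * x + d₂ * y) hu hv ⟩
    d₁ * (c₂ * d) + d₂ * (c * d₁)                 ≡⟨ solve (d₁ ∷ c₂ ∷ d₂ ∷ c ∷ d ∷ []) ⟩
    d * (c₂ * d₁) + c * d₁ * d₂                   ≡⟨ cong (λ x → d * x + c * d₁ * d₂) nb ⟩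
    d * (1 + c₁ * d₂) + c * d₁ * d₂               ≡⟨ solve (c₁ ∷ d₁ ∷ d₂ ∷ c ∷ d ∷ []) ⟩
    d + (c * d₁ * d₂ + c₁ * d * d₂)               ∎)
  numerators : c₁ * u + c₂ * v ≡ c
  numerators = +-cancelʳ-≡ (c₁ * c * d₂ + c₁ * c₂ * d) _ _ (begin
    c₁ * u + c₂ * v + (c₁ * c * d₂ + c₁ * c₂ * d) ≡⟨ solve (c₁ ∷ c₂ ∷ d₂ ∷ c ∷ d ∷ u ∷ v ∷ []) ⟩
    c₁ * (c * d₂ + u) + c₂ * (c₁ * d + v)         ≡⟨ cong₂ (λ x y → c₁ * x + c₂ * y) hu hv ⟩
    c₁ * (c₂ * d) + c₂ * (c * d₁)                 ≡⟨ solve (c₁ ∷ c₂ ∷ d₁ ∷ c ∷ d ∷ []) ⟩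
    c * (c₂ * d₁) + c₁ * c₂ * d                   ≡⟨ cong (λ x → c * x + c₁ * c₂ * d) nb ⟩
    c * (1 + c₁ * d₂) + c₁ * c₂ * d               ≡⟨ solve (c₁ ∷ c₂ ∷ d₂ ∷ c ∷ d ∷ []) ⟩
    c + (c₁ * c * d₂ + c₁ * c₂ * d)               ∎)

between-neighbours : ∀ {c₁ d₁ c₂ d₂ c d} → c₂ * d₁ ≡ 1 + c₁ * d₂ →
                     c₁ * d < c * d₁ → c * d₂ < c₂ * d → d₁ + d₂ ≤ d × c₁ + c₂ ≤ c
between-neighbours {c₁} {d₁} {c₂} {d₂} {c} {d} nb lt₁ lt₂
  with v , hv ← m≤n⇒∃[o]m+o≡n lt₁ | u , hu ← m≤n⇒∃[o]m+o≡n lt₂ =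
  let ds , cs = mediant-decomposition {c₁} {d₁} {c₂} {d₂} {c} {d} {suc u} {suc v} nb (trans (+-suc _ v) hv) (trans (+-suc _ u) hu)
  in ≤-trans (+-mono-≤ (m≤m*n d₁ (suc u)) (m≤m*n d₂ (suc v))) (≤-reflexive ds) ,
     ≤-trans (+-mono-≤ (m≤m*n c₁ (suc u)) (m≤m*n c₂ (suc v))) (≤-reflexive cs)

frac-<-trans : ∀ {c₁ d₁ c₂ d₂ c₃ d₃} → 1 ≤ d₁ →
               c₁ * d₂ < c₂ * d₁ → c₂ * d₃ < c₃ * d₂ → c₁ * d₃ < c₃ * d₁
frac-<-trans {c₁} {d₁} {c₂} {d₂} {c₃} {d₃} 1≤d₁ lt₁ lt₂ = *-cancelʳ-< d₂ _ _ (begin-strict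
  c₁ * d₃ * d₂ ≡⟨ solve (c₁ ∷ d₂ ∷ d₃ ∷ []) ⟩
  c₁ * d₂ * d₃ ≤⟨ *-monoˡ-≤ d₃ (<⇒≤ lt₁) ⟩
  c₂ * d₁ * d₃ ≡⟨ solve (c₂ ∷ d₁ ∷ d₃ ∷ []) ⟩
  c₂ * d₃ * d₁ <⟨ *-monoˡ-< d₁ {{>-nonZero 1≤d₁}} lt₂ ⟩
  c₃ * d₂ * d₁ ≡⟨ solve (c₃ ∷ d₁ ∷ d₂ ∷ []) ⟩
  c₃ * d₁ * d₂ ∎)
  where open ≤-Reasoning

coprime-frac-injective : ∀ {a q c d} → Coprime a q → Coprime c d → 1 ≤ q → 1 ≤ d →
                         a * d ≡ c * q → q ≡ d × a ≡ c
coprime-frac-injective {a} {q} {c} {d} a⊥q c⊥d 1≤q 1≤d eq =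
  q≡d , *-cancelʳ-≡ a c d {{>-nonZero 1≤d}} (trans eq (cong (c *_) q≡d))
  where
  q≡d : q ≡ d
  q≡d = ≤-antisym
    (∣⇒≤ {{>-nonZero 1≤d}} (coprime-divisor (coprime-sym a⊥q) (subst (q ∣_) (sym eq) (n∣m*n c))))
    (∣⇒≤ {{>-nonZero 1≤q}} (coprime-divisor (coprime-sym c⊥d) (subst (d ∣_) eq (n∣m*n a))))

*<*⇒< : ∀ {k q a b} → k * q < a * b → b ≤ q → k < a
*<*⇒< {k} {q} {a} {b} lt b≤q = *-cancelʳ-< q k a (≤-trans lt (*-monoʳ-≤ a b≤q))

numerator<denominator : ∀ {a₁ q₁ a₂ q₂} → a₁ * q₂ < a₂ * q₁ → a₂ ≤ q₂ → a₁ < q₁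
numerator<denominator {a₁} {q₁} {a₂} {q₂} lt a₂≤q₂ =
  *<*⇒< {a₁} {q₂} {q₁} {a₂} (subst (a₁ * q₂ <_) (*-comm a₂ q₁) lt) a₂≤q₂

-- Membership in 𝔖𝔉_Q

InSF⇒≤ : ∀ {Q a q} → InSF Q a q → q ≤ Q
InSF⇒≤ (_ , _ , _ , inj₁ (refl , 3≤Q)) = ≤-trans (s≤s z≤n) 3≤Q
InSF⇒≤ {Q} {a} {q} (_ , _ , _ , inj₂ (_ , b , _ , h)) = ≤-trans (≤-trans (m≤m+n q a) (m≤m+n (q + a) b)) h

InSF-inverse : ∀ {Q a q} → InSF Q a q → 2 ≤ q → ∃ λ b → ModInv q a b × q + a + b ≤ Q
InSF-inverse (_ , _ , _ , inj₁ (refl , _)) (s≤s ())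
InSF-inverse (_ , _ , _ , inj₂ (_ , b , inv , h)) _ = b , inv , h

InSF-height : ∀ {Q a q b} → InSF Q a q → 2 ≤ q → ModInv q a b → q + a + b ≤ Q
InSF-height {Q} {a} {q} sf 2≤q inv with _ , inv′ , h ← InSF-inverse sf 2≤q =
  subst (λ b → q + a + b ≤ Q) (modInv-unique {a = a} inv′ inv) h

InSF-intro : ∀ {Q a q} → 1 ≤ a → a ≤ q → 2 ≤ q → (∃ λ b → ModInv q a b × q + a + b ≤ Q) → InSF Q a q
InSF-intro {a = a} {q} 1≤a a≤q 2≤q (b , inv@(_ , _ , k , eq) , h) =
  1≤a , a≤q , unimodular⇒coprime {a} {q} b k (trans (*-comm b a) eq) , inj₂ (2≤q , b , inv , h)

left-neighbour-InSF : ∀ {Q a q b k} → a * b ≡ 1 + k * q →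
                      1 ≤ k → k < b → b ≤ q → k ≤ a → q + a + b ≤ Q → InSF Q k b
left-neighbour-InSF {Q} {a} {q} {b} {k} eq 1≤k k<b b≤q k≤a h =
  InSF-intro 1≤k (<⇒≤ k<b) 2≤b (_ , inv ,
    ≤-trans (+-mono-≤ (+-mono-≤ b≤q k≤a) (<⇒≤ (proj₁ (proj₂ inv)))) h)
  where
  2≤b : 2 ≤ b
  2≤b = ≤-trans (s≤s 1≤k) k<b
  instance
    b≢0 : NonZero b
    b≢0 = >-nonZero (≤-trans 1≤k (<⇒≤ k<b))
  inv : ModInv b k (b ∸ q % b)
  inv = modInv-∸% k q a 2≤b (trans (+-comm (k * q) 1) (sym eq))

right-neighbour-InSF : ∀ {Q a q b c e} → c * q ≡ 1 + a * e →
                       1 ≤ c → c < e → b + e ≡ q → c ≤ a → q + a + b ≤ Q → InSF Q c e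
right-neighbour-InSF {Q} {a} {q} {b} {c} {e} eq 1≤c c<e b+e≡q c≤a h =
  InSF-intro 1≤c (<⇒≤ c<e) 2≤e (_ , inv ,
    ≤-trans (+-mono-≤ (+-mono-≤ (m≤n+m e b) c≤a) q%e≤b) (subst (λ x → x + a + b ≤ Q) (sym b+e≡q) h))
  where
  2≤e : 2 ≤ e
  2≤e = ≤-trans (s≤s 1≤c) c<e
  instance
    e≢0 : NonZero e
    e≢0 = >-nonZero (≤-trans 1≤c (<⇒≤ c<e))
  inv : ModInv e c (q % e)
  inv = modInv-% c q a 2≤e eq
  q%e≤b : q % e ≤ b
  q%e≤b = begin
    q % e       ≡⟨ cong (_% e) b+e≡q ⟨
    (b + e) % e ≡⟨ [m+n]%n≡m%n b e ⟩
    b % e       ≤⟨ m%n≤m b e ⟩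
    b           ∎
    where open ≤-Reasoning

right-neighbour-identity : ∀ {b e k c} → (k + c) * b ≡ 1 + k * (b + e) → c * (b + e) ≡ 1 + (k + c) * e
right-neighbour-identity {b} {e} {k} {c} eq = +-cancelʳ-≡ (k * b) _ _ (begin
  c * (b + e) + k * b         ≡⟨ solve (b ∷ e ∷ k ∷ c ∷ []) ⟩
  (k + c) * b + c * e         ≡⟨ cong (_+ c * e) eq ⟩
  1 + k * (b + e) + c * e     ≡⟨ solve (b ∷ e ∷ k ∷ c ∷ []) ⟩
  1 + (k + c) * e + k * b     ∎)
  where open ≡-Reasoning

right-neighbour : ∀ {q a b k} → a * b ≡ 1 + k * q → b < q →
                  ∃₂ λ c e → c * q ≡ 1 + a * e × b + e ≡ q × c ≤ a
right-neighbour {q} {a} {b} {k} eq b<q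
  with e , refl ← m≤n⇒∃[o]m+o≡n (<⇒≤ b<q)
     | c , refl ← m≤n⇒∃[o]m+o≡n (<⇒≤ (*<*⇒< {k} {q} {a} {b} (≤-reflexive (sym eq)) (<⇒≤ b<q))) =
  c , e , right-neighbour-identity {b} {e} {k} {c} eq , refl , m≤n+m c k

-- Consecutive pairs lie in 𝒱

unimodular-via-left-neighbour : ∀ {Q a₁ q₁ a₂ q₂ b} → Consecutive Q a₁ q₁ a₂ q₂ → q₁ ≤ q₂ →
                                ModInv q₂ a₂ b → q₂ + a₂ + b ≤ Q → a₂ * q₁ ≡ 1 + a₁ * q₂
unimodular-via-left-neighbour {Q} {a₁} {q₁} {a₂} {q₂} {b}
  ((1≤a₁ , a₁≤q₁ , a₁⊥q₁ , _) , (_ , a₂≤q₂ , _) , lt , nothing-between) q₁≤q₂ (1≤b , b<q₂ , k , eq) h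
  with <-cmp (a₁ * b) (k * q₁)
... | tri< a₁/q₁<k/b _ _ =
  ⊥-elim (nothing-between k b (left-neighbour-InSF eq 1≤k k<b (<⇒≤ b<q₂) k≤a₂ h) a₁/q₁<k/b k/b<a₂/q₂)
  where
  k/b<a₂/q₂ : k * q₂ < a₂ * b
  k/b<a₂/q₂ = ≤-reflexive (sym eq)
  1≤k : 1 ≤ k
  1≤k = n≢0⇒n>0 λ { refl → n≮0 a₁/q₁<k/b }
  k<b : k < b
  k<b = numerator<denominator k/b<a₂/q₂ a₂≤q₂
  k≤a₂ : k ≤ a₂
  k≤a₂ = <⇒≤ (*<*⇒< {k} {q₂} {a₂} {b} k/b<a₂/q₂ (<⇒≤ b<q₂))
... | tri> _ _ k/b<a₁/q₁ = ⊥-elim (<-irrefl refl (begin-strict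
  q₂     <⟨ +-monoˡ-≤ q₂ 1≤b ⟩
  b + q₂ ≤⟨ proj₁ (between-neighbours {k} {b} {a₂} {q₂} {a₁} {q₁} eq k/b<a₁/q₁ lt) ⟩
  q₁     ≤⟨ q₁≤q₂ ⟩
  q₂     ∎))
  where open ≤-Reasoning
... | tri≈ _ a₁b≡kq₁ _
  with coprime-frac-injective a₁⊥q₁ k⊥b (≤-trans 1≤a₁ a₁≤q₁) 1≤b a₁b≡kq₁
  where
  k⊥b : Coprime k b
  k⊥b = coprime-sym (unimodular⇒coprime {b} {k} a₂ q₂ (trans eq (cong (1 +_) (*-comm k q₂))))
... | refl , refl = eq

unimodular-via-right-neighbour : ∀ {Q a₁ q₁ a₂ q₂ b} → Consecutive Q a₁ q₁ a₂ q₂ → q₂ < q₁ →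
                                 ModInv q₁ a₁ b → q₁ + a₁ + b ≤ Q → a₂ * q₁ ≡ 1 + a₁ * q₂
unimodular-via-right-neighbour {Q} {a₁} {q₁} {a₂} {q₂} {b}
  (_ , (1≤a₂ , a₂≤q₂ , a₂⊥q₂ , _) , lt , nothing-between) q₂<q₁ (1≤b , b<q₁ , k , eq) h
  with c , e , eq′ , b+e≡q₁ , c≤a₁ ← right-neighbour {q₁} {a₁} {b} {k} eq b<q₁
     | <-cmp (c * q₂) (a₂ * e)
... | tri< c/e<a₂/q₂ _ _ =
  ⊥-elim (nothing-between c e (right-neighbour-InSF eq′ 1≤c c<e b+e≡q₁ c≤a₁ h) (≤-reflexive (sym eq′)) c/e<a₂/q₂)
  where
  1≤c : 1 ≤ c
  1≤c = n≢0⇒n>0 λ { refl → 0≢1+n eq′ }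
  c<e : c < e
  c<e = numerator<denominator c/e<a₂/q₂ a₂≤q₂
... | tri> _ _ a₂/q₂<c/e = ⊥-elim (<-irrefl refl (begin-strict
  q₁     ≤⟨ m≤m+n q₁ e ⟩
  q₁ + e ≤⟨ proj₁ (between-neighbours {a₁} {q₁} {c} {e} {a₂} {q₂} eq′ lt a₂/q₂<c/e) ⟩
  q₂     <⟨ q₂<q₁ ⟩
  q₁     ∎))
  where open ≤-Reasoning
... | tri≈ _ cq₂≡a₂e _
  with coprime-frac-injective c⊥e a₂⊥q₂ 1≤e (≤-trans 1≤a₂ a₂≤q₂) cq₂≡a₂e
  where
  c⊥e : Coprime c e
  c⊥e = unimodular⇒coprime {c} {e} q₁ a₁ (trans (*-comm q₁ c) eq′)
  1≤e : 1 ≤ e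
  1≤e = n≢0⇒n>0 λ { refl → <-irrefl (trans (sym (+-identityʳ b)) b+e≡q₁) b<q₁ }
... | refl , refl = eq′

consecutive⇒2≤q₁ : ∀ {Q a₁ q₁ a₂ q₂} → Consecutive Q a₁ q₁ a₂ q₂ → 2 ≤ q₁
consecutive⇒2≤q₁ ((1≤a₁ , _) , (_ , a₂≤q₂ , _) , lt , _) = ≤-trans (s≤s 1≤a₁) (numerator<denominator lt a₂≤q₂)

consecutive⇒unimodular : ∀ {Q a₁ q₁ a₂ q₂} → Consecutive Q a₁ q₁ a₂ q₂ → a₂ * q₁ ≡ 1 + a₁ * q₂
consecutive⇒unimodular {q₁ = q₁} {q₂ = q₂} con@(sf₁ , sf₂ , _) with q₁ ≤? q₂
... | yes q₁≤q₂ = let _ , inv , h = InSF-inverse sf₂ (≤-trans (consecutive⇒2≤q₁ con) q₁≤q₂) in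
                  unimodular-via-left-neighbour con q₁≤q₂ inv h
... | no q₁≰q₂ = let _ , inv , h = InSF-inverse sf₁ (consecutive⇒2≤q₁ con) in
                 unimodular-via-right-neighbour con (≰⇒> q₁≰q₂) inv h

-- (a/N, b/N) ∈ 𝒱, with the denominator N cleared.
Region : ℕ → ℕ → ℕ → Set
Region N a b = a ≤ N × b ≤ N × N ≤ 3 * a + 2 * b × 2 * a ≤ N + b × (a + b ≤ N ⊎ b ≤ a)

modInv-∸ : ∀ {a₁ q₁ a₂ q₂} → a₂ * q₁ ≡ 1 + a₁ * q₂ → 1 ≤ q₂ → q₂ < q₁ → ModInv q₁ a₁ (q₁ ∸ q₂)
modInv-∸ {a₁} {q₁} {a₂} {q₂} nb 1≤q₂ q₂<q₁ =
  m<n⇒0<n∸m q₂<q₁ , ∸-monoʳ-< 1≤q₂ (<⇒≤ q₂<q₁) ,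
  congruent-1 a₂ a₁ (≤-trans (s≤s 1≤q₂) q₂<q₁) (congruence (q₁ ∸ q₂) (m∸n+n≡m (<⇒≤ q₂<q₁)))
  where
  open ≡-Reasoning
  congruence : ∀ d → d + q₂ ≡ q₁ → a₁ * d + a₂ * q₁ ≡ 1 + a₁ * q₁
  congruence d d+q₂≡q₁ = begin
    a₁ * d + a₂ * q₁       ≡⟨ cong (a₁ * d +_) nb ⟩
    a₁ * d + (1 + a₁ * q₂) ≡⟨ solve (a₁ ∷ d ∷ q₂ ∷ []) ⟩
    1 + a₁ * (d + q₂)      ≡⟨ cong (λ x → 1 + a₁ * x) d+q₂≡q₁ ⟩
    1 + a₁ * q₁            ∎

mediant-InSF : ∀ {Q a₁ q₁ a₂ q₂} → a₂ * q₁ ≡ 1 + a₁ * q₂ →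
               1 ≤ a₁ → a₁ ≤ q₁ → 1 ≤ a₂ → a₂ ≤ q₂ → 3 * q₁ + 2 * q₂ ≤ Q →
               InSF Q (a₁ + a₂) (q₁ + q₂) × a₁ * (q₁ + q₂) < (a₁ + a₂) * q₁ × (a₁ + a₂) * q₂ < a₂ * (q₁ + q₂)
mediant-InSF {Q} {a₁} {q₁} {a₂} {q₂} nb 1≤a₁ a₁≤q₁ 1≤a₂ a₂≤q₂ bound =
  InSF-intro (≤-trans 1≤a₁ (m≤m+n a₁ a₂)) (+-mono-≤ a₁≤q₁ a₂≤q₂) (+-mono-≤ 1≤q₁ 1≤q₂)
    (q₁ , (1≤q₁ , m<m+n q₁ 1≤q₂ , a₁ , left) , height) ,
  ≤-reflexive (sym left) , ≤-reflexive (sym right)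
  where
  1≤q₁ : 1 ≤ q₁
  1≤q₁ = ≤-trans 1≤a₁ a₁≤q₁
  1≤q₂ : 1 ≤ q₂
  1≤q₂ = ≤-trans 1≤a₂ a₂≤q₂
  left : (a₁ + a₂) * q₁ ≡ 1 + a₁ * (q₁ + q₂)
  left = begin
    (a₁ + a₂) * q₁           ≡⟨ *-distribʳ-+ q₁ a₁ a₂ ⟩
    a₁ * q₁ + a₂ * q₁        ≡⟨ cong (a₁ * q₁ +_) nb ⟩
    a₁ * q₁ + (1 + a₁ * q₂)  ≡⟨ solve (a₁ ∷ q₁ ∷ q₂ ∷ []) ⟩
    1 + a₁ * (q₁ + q₂)       ∎
    where open ≡-Reasoning
  right : a₂ * (q₁ + q₂) ≡ 1 + (a₁ + a₂) * q₂
  right = begin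
    a₂ * (q₁ + q₂)           ≡⟨ *-distribˡ-+ a₂ q₁ q₂ ⟩
    a₂ * q₁ + a₂ * q₂        ≡⟨ cong (_+ a₂ * q₂) nb ⟩
    1 + a₁ * q₂ + a₂ * q₂    ≡⟨ solve (a₁ ∷ a₂ ∷ q₂ ∷ []) ⟩
    1 + (a₁ + a₂) * q₂       ∎
    where open ≡-Reasoning
  height : q₁ + q₂ + (a₁ + a₂) + q₁ ≤ Q
  height = begin
    q₁ + q₂ + (a₁ + a₂) + q₁ ≤⟨ +-monoˡ-≤ q₁ (+-monoʳ-≤ (q₁ + q₂) (+-mono-≤ a₁≤q₁ a₂≤q₂)) ⟩
    q₁ + q₂ + (q₁ + q₂) + q₁ ≡⟨ solve (q₁ ∷ q₂ ∷ []) ⟩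
    3 * q₁ + 2 * q₂          ≤⟨ bound ⟩
    Q                        ∎
    where open ≤-Reasoning

consecutive⇒Region : ∀ {Q a₁ q₁ a₂ q₂} → Consecutive Q a₁ q₁ a₂ q₂ → Region Q q₁ q₂
consecutive⇒Region {Q} {a₁} {q₁} {a₂} {q₂}
  con@(sf₁@(1≤a₁ , a₁≤q₁ , _) , sf₂@(1≤a₂ , a₂≤q₂ , _) , _ , nothing-between) =
  InSF⇒≤ sf₁ , InSF⇒≤ sf₂ , mediant-bound , left-bound , right-bound
  where
  open ≤-Reasoning
  nb : a₂ * q₁ ≡ 1 + a₁ * q₂
  nb = consecutive⇒unimodular con
  2≤q₁ : 2 ≤ q₁
  2≤q₁ = consecutive⇒2≤q₁ con
  1≤q₂ : 1 ≤ q₂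
  1≤q₂ = ≤-trans 1≤a₂ a₂≤q₂
  mediant-bound : Q ≤ 3 * q₁ + 2 * q₂
  mediant-bound with Q ≤? 3 * q₁ + 2 * q₂
  ... | yes Q≤ = Q≤
  ... | no Q≰ = let sf , l , r = mediant-InSF nb 1≤a₁ a₁≤q₁ 1≤a₂ a₂≤q₂ (<⇒≤ (≰⇒> Q≰)) in
                ⊥-elim (nothing-between _ _ sf l r)
  left-bound : 2 * q₁ ≤ Q + q₂
  left-bound with q₁ ≤? q₂
  ... | yes q₁≤q₂ = subst (_≤ Q + q₂) (cong (q₁ +_) (sym (+-identityʳ q₁))) (+-mono-≤ (InSF⇒≤ sf₁) q₁≤q₂)
  ... | no q₁≰q₂ = begin
    2 * q₁                   ≡⟨ cong (q₁ +_) (+-identityʳ q₁) ⟩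
    q₁ + q₁                  ≡⟨ cong (q₁ +_) (m∸n+n≡m (<⇒≤ q₂<q₁)) ⟨
    q₁ + (q₁ ∸ q₂ + q₂)      ≡⟨ +-assoc q₁ _ q₂ ⟨
    q₁ + (q₁ ∸ q₂) + q₂      ≤⟨ +-monoˡ-≤ q₂ (+-monoˡ-≤ (q₁ ∸ q₂) (m≤m+n q₁ a₁)) ⟩
    q₁ + a₁ + (q₁ ∸ q₂) + q₂ ≤⟨ +-monoˡ-≤ q₂ (InSF-height sf₁ 2≤q₁ (modInv-∸ {a₁} {q₁} {a₂} {q₂} nb 1≤q₂ q₂<q₁)) ⟩
    Q + q₂                   ∎
    where
    q₂<q₁ : q₂ < q₁
    q₂<q₁ = ≰⇒> q₁≰q₂
  right-bound : q₁ + q₂ ≤ Q ⊎ q₂ ≤ q₁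
  right-bound with q₂ ≤? q₁
  ... | yes q₂≤q₁ = inj₂ q₂≤q₁
  ... | no q₂≰q₁ = inj₁ (begin
    q₁ + q₂      ≡⟨ +-comm q₁ q₂ ⟩
    q₂ + q₁      ≤⟨ +-monoˡ-≤ q₁ (m≤m+n q₂ a₂) ⟩
    q₂ + a₂ + q₁ ≤⟨ InSF-height sf₂ (≤-trans 2≤q₁ (<⇒≤ q₁<q₂)) (≤-trans 1≤a₁ a₁≤q₁ , q₁<q₂ , a₁ , nb) ⟩
    Q            ∎)
    where
    q₁<q₂ : q₁ < q₂
    q₁<q₂ = ≰⇒> q₂≰q₁

-- A criterion for consecutive pairs

height-between-neighbours : ∀ {Q a₁ q₁ a₂ q₂ a q} → a₂ * q₁ ≡ 1 + a₁ * q₂ → Coprime a₁ q₁ → 1 ≤ q₁ → 1 ≤ q₂ →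
                            InSF Q a q → a₁ * q < a * q₁ → a * q₂ < a₂ * q → 2 * q₁ + q₂ + a₁ + a₂ ≤ Q
height-between-neighbours {Q} {a₁} {q₁} {a₂} {q₂} {a} {q} nb a₁⊥q₁ 1≤q₁ 1≤q₂ sf lt₁ lt₂
  with q₁+q₂≤q , a₁+a₂≤a ← between-neighbours {a₁} {q₁} {a₂} {q₂} {a} {q} nb lt₁ lt₂
  with b , (1≤b , b<q , k , eq) , h ← InSF-inverse sf (≤-trans (+-mono-≤ 1≤q₁ 1≤q₂) q₁+q₂≤q) = begin
    2 * q₁ + q₂ + a₁ + a₂     ≡⟨ solve (a₁ ∷ q₁ ∷ a₂ ∷ q₂ ∷ []) ⟩
    q₁ + q₂ + (a₁ + a₂) + q₁  ≤⟨ +-mono-≤ (+-mono-≤ q₁+q₂≤q a₁+a₂≤a) q₁≤b ⟩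
    q + a + b                 ≤⟨ h ⟩
    Q                         ∎
  where
  open ≤-Reasoning
  k/b<a/q : k * q < a * b
  k/b<a/q = ≤-reflexive (sym eq)
  -- k/b is the left Farey neighbour of a/q, so it cannot lie strictly between a₁/q₁ and a/q.
  q₁≤b : q₁ ≤ b
  q₁≤b with <-cmp (a₁ * b) (k * q₁)
  ... | tri< a₁/q₁<k/b _ _ = ≤-trans (m≤m+n q₁ q₂)
    (proj₁ (between-neighbours {a₁} {q₁} {a₂} {q₂} {k} {b} nb a₁/q₁<k/b
      (frac-<-trans {k} {b} {a} {q} {a₂} {q₂} 1≤b k/b<a/q lt₂)))
  ... | tri≈ _ a₁b≡kq₁ _ = ∣⇒≤ {{>-nonZero 1≤b}}
    (coprime-divisor (coprime-sym a₁⊥q₁) (subst (q₁ ∣_) (sym a₁b≡kq₁) (n∣m*n k)))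
  ... | tri> _ _ k/b<a₁/q₁ = ⊥-elim (<-irrefl refl (begin-strict
    q₁      <⟨ m<m+n q₁ 1≤q₂ ⟩
    q₁ + q₂ ≤⟨ q₁+q₂≤q ⟩
    q       ≤⟨ m≤n+m q b ⟩
    b + q   ≤⟨ proj₁ (between-neighbours {k} {b} {a} {q} {a₁} {q₁} eq k/b<a₁/q₁ lt₁) ⟩
    q₁      ∎))

neighbours⇒consecutive : ∀ {Q a₁ q₁ a₂ q₂} → a₂ * q₁ ≡ 1 + a₁ * q₂ → InSF Q a₁ q₁ → InSF Q a₂ q₂ →
                         Q < 2 * q₁ + q₂ + a₁ + a₂ → Consecutive Q a₁ q₁ a₂ q₂
neighbours⇒consecutive nb sf₁@(1≤a₁ , a₁≤q₁ , a₁⊥q₁ , _) sf₂@(1≤a₂ , a₂≤q₂ , _) Q<h =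
  sf₁ , sf₂ , ≤-reflexive (sym nb) , λ a q sf lt₁ lt₂ →
    <-irrefl refl (<-≤-trans Q<h (height-between-neighbours nb a₁⊥q₁ (≤-trans 1≤a₁ a₁≤q₁) (≤-trans 1≤a₂ a₂≤q₂) sf lt₁ lt₂))

-- Enough for h(a₁/q₁) ≤ Q and h(a₂/q₂) ≤ Q when a₂q₁ = 1 + a₁q₂, since the inverses
-- are then −q₂ mod q₁ and q₁ mod q₂.
HeightConditions : ℕ → ℕ → ℕ → ℕ → ℕ → Set
HeightConditions Q a₁ q₁ a₂ q₂ =
  (2 * q₁ + a₁ ≤ Q × q₁ + q₂ + a₂ ≤ Q) ⊎ (q₂ < q₁ × 2 * q₁ + a₁ ≤ Q + q₂ × q₁ + a₂ ≤ Q)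

consecutive-criterion : ∀ {Q a₁ q₁ a₂ q₂} → a₂ * q₁ ≡ 1 + a₁ * q₂ →
  1 ≤ a₁ → a₁ ≤ q₁ → 1 ≤ a₂ → a₂ ≤ q₂ → 2 ≤ q₂ → Q < 2 * q₁ + q₂ + a₁ + a₂ →
  HeightConditions Q a₁ q₁ a₂ q₂ → Consecutive Q a₁ q₁ a₂ q₂
consecutive-criterion {Q} {a₁} {q₁} {a₂} {q₂} nb 1≤a₁ a₁≤q₁ 1≤a₂ a₂≤q₂ 2≤q₂ Q<h heights =
  neighbours⇒consecutive nb (InSF-intro 1≤a₁ a₁≤q₁ 2≤q₁ (left-inverse heights))
    (InSF-intro 1≤a₂ a₂≤q₂ 2≤q₂ (q₁ % q₂ , modInv-% a₂ q₁ a₁ 2≤q₂ nb , right-height heights)) Q<h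
  where
  open ≤-Reasoning
  2≤q₁ : 2 ≤ q₁
  2≤q₁ = ≤-trans (s≤s 1≤a₁) (numerator<denominator {a₁} {q₁} {a₂} {q₂} (≤-reflexive (sym nb)) a₂≤q₂)
  instance
    q₁≢0 : NonZero q₁
    q₁≢0 = >-nonZero (≤-trans (s≤s z≤n) 2≤q₁)
    q₂≢0 : NonZero q₂
    q₂≢0 = >-nonZero (≤-trans (s≤s z≤n) 2≤q₂)
  left-inverse : HeightConditions Q a₁ q₁ a₂ q₂ → ∃ λ b → ModInv q₁ a₁ b × q₁ + a₁ + b ≤ Q
  left-inverse (inj₁ (h₁ , _)) = _ , inv , (begin
    q₁ + a₁ + (q₁ ∸ q₂ % q₁) ≤⟨ +-monoʳ-≤ (q₁ + a₁) (<⇒≤ (proj₁ (proj₂ inv))) ⟩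
    q₁ + a₁ + q₁             ≡⟨ solve (q₁ ∷ a₁ ∷ []) ⟩
    2 * q₁ + a₁              ≤⟨ h₁ ⟩
    Q                        ∎)
    where
    inv : ModInv q₁ a₁ (q₁ ∸ q₂ % q₁)
    inv = modInv-∸% a₁ q₂ a₂ 2≤q₁ (trans (+-comm (a₁ * q₂) 1) (sym nb))
  left-inverse (inj₂ (q₂<q₁ , h₁ , _)) = _ , modInv-∸ {a₁} {q₁} {a₂} {q₂} nb (≤-trans (s≤s z≤n) 2≤q₂) q₂<q₁ ,
    +-cancelʳ-≤ q₂ _ _ (begin
      q₁ + a₁ + (q₁ ∸ q₂) + q₂   ≡⟨ +-assoc (q₁ + a₁) _ q₂ ⟩
      q₁ + a₁ + (q₁ ∸ q₂ + q₂)   ≡⟨ cong (q₁ + a₁ +_) (m∸n+n≡m (<⇒≤ q₂<q₁)) ⟩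
      q₁ + a₁ + q₁               ≡⟨ solve (q₁ ∷ a₁ ∷ []) ⟩
      2 * q₁ + a₁                ≤⟨ h₁ ⟩
      Q + q₂                     ∎)
  right-height : HeightConditions Q a₁ q₁ a₂ q₂ → q₂ + a₂ + q₁ % q₂ ≤ Q
  right-height (inj₁ (_ , h₂)) = begin
      q₂ + a₂ + q₁ % q₂ ≤⟨ +-monoʳ-≤ (q₂ + a₂) (m%n≤m q₁ q₂) ⟩
      q₂ + a₂ + q₁      ≡⟨ solve (q₁ ∷ q₂ ∷ a₂ ∷ []) ⟩
      q₁ + q₂ + a₂      ≤⟨ h₂ ⟩
      Q                 ∎
  right-height (inj₂ (q₂<q₁ , _ , h₂)) = begin
      q₂ + a₂ + q₁ % q₂            ≡⟨ rearrange (q₁ % q₂) ⟩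
      a₂ + (q₁ % q₂ + q₂)          ≤⟨ +-monoʳ-≤ a₂ (+-monoˡ-≤ q₂ q₁%q₂≤q₁∸q₂) ⟩
      a₂ + (q₁ ∸ q₂ + q₂)          ≡⟨ cong (a₂ +_) (m∸n+n≡m (<⇒≤ q₂<q₁)) ⟩
      a₂ + q₁                      ≡⟨ +-comm a₂ q₁ ⟩
      q₁ + a₂                      ≤⟨ h₂ ⟩
      Q                            ∎
      where
      rearrange : ∀ r → q₂ + a₂ + r ≡ a₂ + (r + q₂)
      rearrange r = solve (q₂ ∷ a₂ ∷ r ∷ [])
      q₁%q₂≤q₁∸q₂ : q₁ % q₂ ≤ q₁ ∸ q₂
      q₁%q₂≤q₁∸q₂ = begin
        q₁ % q₂              ≡⟨ cong (_% q₂) (m∸n+n≡m (<⇒≤ q₂<q₁)) ⟨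
        (q₁ ∸ q₂ + q₂) % q₂  ≡⟨ [m+n]%n≡m%n (q₁ ∸ q₂) q₂ ⟩
        (q₁ ∸ q₂) % q₂       ≤⟨ m%n≤m (q₁ ∸ q₂) q₂ ⟩
        q₁ ∸ q₂              ∎

-- Consecutive pairs near a given point

unimodular-product : ∀ {p r p′ r′ A₁ A₂ i j} → p * r′ ≡ 1 + p′ * r → A₂ * i ≡ 1 + A₁ * j →
                     (p * A₂ + p′ * j) * (r * A₁ + r′ * i) ≡ 1 + (p * A₁ + p′ * i) * (r * A₂ + r′ * j)
unimodular-product {p} {r} {p′} {r′} {A₁} {A₂} {i} {j} det₁ det₂ = begin
  (p * A₂ + p′ * j) * (r * A₁ + r′ * i)
    ≡⟨ solve (p ∷ r ∷ p′ ∷ r′ ∷ A₁ ∷ A₂ ∷ i ∷ j ∷ []) ⟩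
  p * r * A₁ * A₂ + (p * r′) * (A₂ * i) + (p′ * r) * (A₁ * j) + p′ * r′ * i * j
    ≡⟨ cong₂ (λ x y → p * r * A₁ * A₂ + x * y + (p′ * r) * (A₁ * j) + p′ * r′ * i * j) det₁ det₂ ⟩
  p * r * A₁ * A₂ + (1 + p′ * r) * (1 + A₁ * j) + (p′ * r) * (A₁ * j) + p′ * r′ * i * j
    ≡⟨ solve (p ∷ r ∷ p′ ∷ r′ ∷ A₁ ∷ A₂ ∷ i ∷ j ∷ []) ⟩
  1 + p * r * A₁ * A₂ + (1 + p′ * r) * (A₁ * j) + (p′ * r) * (1 + A₁ * j) + p′ * r′ * i * j
    ≡⟨ cong₂ (λ x y → 1 + p * r * A₁ * A₂ + x * (A₁ * j) + (p′ * r) * y + p′ * r′ * i * j) det₁ det₂ ⟨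
  1 + p * r * A₁ * A₂ + (p * r′) * (A₁ * j) + (p′ * r) * (A₂ * i) + p′ * r′ * i * j
    ≡⟨ solve (p ∷ r ∷ p′ ∷ r′ ∷ A₁ ∷ A₂ ∷ i ∷ j ∷ []) ⟩
  1 + (p * A₁ + p′ * i) * (r * A₂ + r′ * j) ∎
  where open ≡-Reasoning

-- (X/C, Y/C) in the interior of 𝒱, with X, Y > 0.
StrictRegion : ℕ → ℕ → ℕ → Set
StrictRegion C X Y = 1 ≤ X × 1 ≤ Y × X < C × C < 3 * X + 2 * Y × 2 * X < C + Y × (X + Y < C ⊎ Y < X)

-- Q < 2q₁ + q₂ + a₁ + a₂ and HeightConditions in the limit a₁/q₁ = a₂/q₂ = p/r,
-- (q₁, q₂, Q) ∝ (X, Y, C).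
SlopeConditions : ℕ → ℕ → ℕ → ℕ → ℕ → Set
SlopeConditions X Y C p r =
  r * C < 2 * r * X + r * Y + p * X + p * Y ×
  ((2 * r * X + p * X < r * C × r * X + r * Y + p * Y < r * C) ⊎
   (Y < X × 2 * r * X + p * X < r * C + r * Y × r * X + p * Y < r * C))

scaled-< : ∀ R {A B c} → A < B → c < R → R * A + c < R * B
scaled-< R {A} {B} {c} A<B c<R = begin-strict
  R * A + c   <⟨ +-monoʳ-< (R * A) c<R ⟩
  R * A + R   ≡⟨ solve (R ∷ A ∷ []) ⟩
  R * suc A   ≤⟨ *-monoʳ-≤ R A<B ⟩
  R * B       ∎
  where open ≤-Reasoning

<-square-of-sum : ∀ {X Y} → 1 ≤ Y → X < (X + Y) * (X + Y)
<-square-of-sum {X} {Y} 1≤Y = <-≤-trans (m<m+n X 1≤Y) (m≤m*n (X + Y) (X + Y) {{>-nonZero (≤-trans 1≤Y (m≤n+m Y X))}})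

shallow-slope : ∀ {C X Y} → StrictRegion C X Y → C ≤ 2 * X + Y →
                SlopeConditions X Y C 1 ((X + Y) * (X + Y))
shallow-slope {C} {X} {Y} (1≤X , 1≤Y , X<C , _ , 2X<C+Y , upper) C≤2X+Y = mediant , sides upper
  where
  open ≤-Reasoning
  r : ℕ
  r = (X + Y) * (X + Y)
  X<r : X < (X + Y) * (X + Y)
  X<r = <-square-of-sum 1≤Y
  Y<r : Y < (X + Y) * (X + Y)
  Y<r = subst (Y <_) (cong₂ _*_ (+-comm Y X) (+-comm Y X)) (<-square-of-sum {Y} {X} 1≤X)
  mediant : (X + Y) * (X + Y) * C < 2 * ((X + Y) * (X + Y)) * X + (X + Y) * (X + Y) * Y + 1 * X + 1 * Y
  mediant = begin-strict
    (X + Y) * (X + Y) * C                     ≤⟨ *-monoʳ-≤ r C≤2X+Y ⟩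
    (X + Y) * (X + Y) * (2 * X + Y)           <⟨ m<m+n _ (≤-trans 1≤X (m≤m+n X Y)) ⟩
    (X + Y) * (X + Y) * (2 * X + Y) + (X + Y) ≡⟨ solve (X ∷ Y ∷ []) ⟩
    2 * ((X + Y) * (X + Y)) * X + (X + Y) * (X + Y) * Y + 1 * X + 1 * Y ∎
  sides : X + Y < C ⊎ Y < X →
          (2 * r * X + 1 * X < r * C × r * X + r * Y + 1 * Y < r * C) ⊎
          (Y < X × 2 * r * X + 1 * X < r * C + r * Y × r * X + 1 * Y < r * C)
  sides upper with X ≤? Y
  sides (inj₂ Y<X)   | yes X≤Y = ⊥-elim (<-irrefl refl (<-≤-trans Y<X X≤Y))
  sides (inj₁ X+Y<C) | yes X≤Y = inj₁ (
    (begin-strict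
      2 * ((X + Y) * (X + Y)) * X + 1 * X ≡⟨ solve (X ∷ Y ∷ []) ⟩
      (X + Y) * (X + Y) * (2 * X) + X     <⟨ scaled-< r 2X<C X<r ⟩
      (X + Y) * (X + Y) * C               ∎) ,
    (begin-strict
      (X + Y) * (X + Y) * X + (X + Y) * (X + Y) * Y + 1 * Y ≡⟨ solve (X ∷ Y ∷ []) ⟩
      (X + Y) * (X + Y) * (X + Y) + Y     <⟨ scaled-< r X+Y<C Y<r ⟩
      (X + Y) * (X + Y) * C               ∎))
    where
    2X<C : 2 * X < C
    2X<C = begin-strict
      2 * X ≡⟨ solve (X ∷ []) ⟩
      X + X ≤⟨ +-monoʳ-≤ X X≤Y ⟩
      X + Y <⟨ X+Y<C ⟩
      C     ∎
  sides _ | no X≰Y = inj₂ (≰⇒> X≰Y ,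
    (begin-strict
      2 * ((X + Y) * (X + Y)) * X + 1 * X ≡⟨ solve (X ∷ Y ∷ []) ⟩
      (X + Y) * (X + Y) * (2 * X) + X     <⟨ scaled-< r 2X<C+Y X<r ⟩
      (X + Y) * (X + Y) * (C + Y)         ≡⟨ *-distribˡ-+ r C Y ⟩
      (X + Y) * (X + Y) * C + (X + Y) * (X + Y) * Y ∎) ,
    (begin-strict
      (X + Y) * (X + Y) * X + 1 * Y       ≡⟨ cong ((X + Y) * (X + Y) * X +_) (*-identityˡ Y) ⟩
      (X + Y) * (X + Y) * X + Y           <⟨ scaled-< r X<C Y<r ⟩
      (X + Y) * (X + Y) * C               ∎))

steep-slope : ∀ {X Y τ} → 1 ≤ X → 1 ≤ Y →
              SlopeConditions X Y (2 * X + Y + τ) ((X + Y) * τ + 1) ((X + Y) * (X + Y))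
steep-slope {X} {Y} {τ} 1≤X 1≤Y = mediant , inj₁ (left , right)
  where
  open ≤-Reasoning
  r : ℕ
  r = (X + Y) * (X + Y)
  X<rY : X < (X + Y) * (X + Y) * Y + (X + Y) * τ * Y
  X<rY = <-≤-trans (<-square-of-sum 1≤Y) (≤-trans (m≤m*n r Y {{>-nonZero 1≤Y}}) (m≤m+n _ _))
  Y<rX : Y < (X + Y) * (X + Y) * X + (X + Y) * τ * X
  Y<rX = <-≤-trans (subst (Y <_) (cong₂ _*_ (+-comm Y X) (+-comm Y X)) (<-square-of-sum {Y} {X} 1≤X))
                   (≤-trans (m≤m*n r X {{>-nonZero 1≤X}}) (m≤m+n _ _))
  mediant : (X + Y) * (X + Y) * (2 * X + Y + τ) <
            2 * ((X + Y) * (X + Y)) * X + (X + Y) * (X + Y) * Y + ((X + Y) * τ + 1) * X + ((X + Y) * τ + 1) * Y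
  mediant = begin-strict
    (X + Y) * (X + Y) * (2 * X + Y + τ)
      ≡⟨ solve (X ∷ Y ∷ τ ∷ []) ⟩
    2 * ((X + Y) * (X + Y)) * X + (X + Y) * (X + Y) * Y + (X + Y) * τ * X + (X + Y) * τ * Y
      <⟨ m<m+n _ (≤-trans 1≤X (m≤m+n X Y)) ⟩
    2 * ((X + Y) * (X + Y)) * X + (X + Y) * (X + Y) * Y + (X + Y) * τ * X + (X + Y) * τ * Y + (X + Y)
      ≡⟨ solve (X ∷ Y ∷ τ ∷ []) ⟩
    2 * ((X + Y) * (X + Y)) * X + (X + Y) * (X + Y) * Y + ((X + Y) * τ + 1) * X + ((X + Y) * τ + 1) * Y ∎
  left : 2 * ((X + Y) * (X + Y)) * X + ((X + Y) * τ + 1) * X < (X + Y) * (X + Y) * (2 * X + Y + τ)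
  left = begin-strict
    2 * ((X + Y) * (X + Y)) * X + ((X + Y) * τ + 1) * X
      ≡⟨ solve (X ∷ Y ∷ τ ∷ []) ⟩
    2 * ((X + Y) * (X + Y)) * X + (X + Y) * τ * X + X
      <⟨ +-monoʳ-< _ X<rY ⟩
    2 * ((X + Y) * (X + Y)) * X + (X + Y) * τ * X + ((X + Y) * (X + Y) * Y + (X + Y) * τ * Y)
      ≡⟨ solve (X ∷ Y ∷ τ ∷ []) ⟩
    (X + Y) * (X + Y) * (2 * X + Y + τ) ∎
  right : (X + Y) * (X + Y) * X + (X + Y) * (X + Y) * Y + ((X + Y) * τ + 1) * Y < (X + Y) * (X + Y) * (2 * X + Y + τ)
  right = begin-strict
    (X + Y) * (X + Y) * X + (X + Y) * (X + Y) * Y + ((X + Y) * τ + 1) * Y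
      ≡⟨ solve (X ∷ Y ∷ τ ∷ []) ⟩
    (X + Y) * (X + Y) * X + (X + Y) * (X + Y) * Y + (X + Y) * τ * Y + Y
      <⟨ +-monoʳ-< _ Y<rX ⟩
    (X + Y) * (X + Y) * X + (X + Y) * (X + Y) * Y + (X + Y) * τ * Y + ((X + Y) * (X + Y) * X + (X + Y) * τ * X)
      ≡⟨ solve (X ∷ Y ∷ τ ∷ []) ⟩
    (X + Y) * (X + Y) * (2 * X + Y + τ) ∎

-- The slope is p/r = τ/S + 1/S² with S = X + Y and τ = max(0, C − 2X − Y); its unimodular
-- partner is given by slope-matrix.
slope-exists : ∀ {C X Y} → StrictRegion C X Y →
               ∃₂ λ τ δ → τ + δ ≡ X + Y × 1 ≤ δ × SlopeConditions X Y C ((X + Y) * τ + 1) ((X + Y) * (X + Y))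
slope-exists {C} {X} {Y} region@(1≤X , 1≤Y , _ , C<3X+2Y , _) with C ≤? 2 * X + Y
... | yes C≤2X+Y =
  0 , X + Y , refl , ≤-trans 1≤X (m≤m+n X Y) ,
  subst (λ p → SlopeConditions X Y C p ((X + Y) * (X + Y))) (cong (_+ 1) (sym (*-zeroʳ (X + Y))))
        (shallow-slope region C≤2X+Y)
... | no C≰2X+Y with τ , refl ← m≤n⇒∃[o]m+o≡n (<⇒≤ (≰⇒> C≰2X+Y)) =
  τ , X + Y ∸ τ , m+[n∸m]≡n (<⇒≤ τ<X+Y) , m<n⇒0<n∸m τ<X+Y , steep-slope 1≤X 1≤Y
  where
  τ<X+Y : τ < X + Y
  τ<X+Y = +-cancelˡ-< (2 * X + Y) τ (X + Y) (begin-strict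
    2 * X + Y + τ       <⟨ C<3X+2Y ⟩
    3 * X + 2 * Y       ≡⟨ solve (X ∷ Y ∷ []) ⟩
    2 * X + Y + (X + Y) ∎)
    where open ≤-Reasoning

slope-matrix : ∀ {S} τ δ → τ + δ ≡ S → 1 ≤ δ →
               (S * τ + 1) * (S * δ + 1) ≡ 1 + (τ * δ + 1) * (S * S) ×
               S * τ + 1 ≤ S * S × τ * δ + 1 ≤ S * δ + 1
slope-matrix τ δ refl 1≤δ =
  solve (τ ∷ δ ∷ []) ,
  (begin
    (τ + δ) * τ + 1             ≤⟨ +-monoʳ-≤ _ (*-mono-≤ (≤-trans 1≤δ (m≤n+m δ τ)) 1≤δ) ⟩
    (τ + δ) * τ + (τ + δ) * δ   ≡⟨ solve (τ ∷ δ ∷ []) ⟩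
    (τ + δ) * (τ + δ)           ∎) ,
  +-monoˡ-≤ 1 (*-monoˡ-≤ δ (m≤m+n τ δ))
  where open ≤-Reasoning

perturbed-consecutive : ∀ m X Y C p r E₁ E₂ F₁ F₂ →
  (m * p * Y + F₂) * (m * r * X + E₁) ≡ 1 + (m * p * X + F₁) * (m * r * Y + E₂) →
  1 ≤ p → p ≤ r → 1 ≤ X → 1 ≤ Y → F₁ ≤ E₁ → F₂ ≤ E₂ → 2 ≤ m → 3 * (E₁ + E₂) < m →
  SlopeConditions X Y C p r →
  Consecutive (m * (r * C)) (m * p * X + F₁) (m * r * X + E₁) (m * p * Y + F₂) (m * r * Y + E₂)
perturbed-consecutive m X Y C p r E₁ E₂ F₁ F₂ nb 1≤p p≤r 1≤X 1≤Y F₁≤E₁ F₂≤E₂ 2≤m 3E<m slope@(mediant , _) =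
  consecutive-criterion nb 1≤a₁ (+-mono-≤ (*-monoˡ-≤ X (*-monoʳ-≤ m p≤r)) F₁≤E₁)
    1≤a₂ (+-mono-≤ (*-monoˡ-≤ Y (*-monoʳ-≤ m p≤r)) F₂≤E₂) 2≤q₂ Q<h (heights slope)
  where
  open ≤-Reasoning
  1≤m : 1 ≤ m
  1≤m = ≤-trans (s≤s z≤n) 2≤m
  instance
    m≢0 : NonZero m
    m≢0 = >-nonZero 1≤m
  m≤m*r* : ∀ {Z} → 1 ≤ Z → m ≤ m * r * Z
  m≤m*r* {Z} 1≤Z = ≤-trans (m≤m*n m r {{>-nonZero (≤-trans 1≤p p≤r)}}) (m≤m*n (m * r) Z {{>-nonZero 1≤Z}})
  1≤a₁ : 1 ≤ m * p * X + F₁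
  1≤a₁ = ≤-trans (*-mono-≤ (*-mono-≤ 1≤m 1≤p) 1≤X) (m≤m+n _ F₁)
  1≤a₂ : 1 ≤ m * p * Y + F₂
  1≤a₂ = ≤-trans (*-mono-≤ (*-mono-≤ 1≤m 1≤p) 1≤Y) (m≤m+n _ F₂)
  2≤q₂ : 2 ≤ m * r * Y + E₂
  2≤q₂ = ≤-trans 2≤m (≤-trans (m≤m*r* 1≤Y) (m≤m+n _ E₂))
  small : ∀ {a b c} → a ≤ E₁ + E₂ → b ≤ E₁ + E₂ → c ≤ E₁ + E₂ → a + b + c < m
  small {a} {b} {c} a≤ b≤ c≤ = begin-strict
    a + b + c                           ≤⟨ +-mono-≤ (+-mono-≤ a≤ b≤) c≤ ⟩
    (E₁ + E₂) + (E₁ + E₂) + (E₁ + E₂)   ≡⟨ solve (E₁ ∷ E₂ ∷ []) ⟩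
    3 * (E₁ + E₂)                       <⟨ 3E<m ⟩
    m                                   ∎
  E₁≤ : E₁ ≤ E₁ + E₂
  E₁≤ = m≤m+n E₁ E₂
  E₂≤ : E₂ ≤ E₁ + E₂
  E₂≤ = m≤n+m E₂ E₁
  Q<h : m * (r * C) < 2 * (m * r * X + E₁) + (m * r * Y + E₂) + (m * p * X + F₁) + (m * p * Y + F₂)
  Q<h = begin-strict
    m * (r * C)                                                   <⟨ *-monoʳ-< m mediant ⟩
    m * (2 * r * X + r * Y + p * X + p * Y)                       ≤⟨ m≤m+n _ (E₁ + E₁ + E₂ + F₁ + F₂) ⟩
    m * (2 * r * X + r * Y + p * X + p * Y) + (E₁ + E₁ + E₂ + F₁ + F₂)
      ≡⟨ solve (m ∷ X ∷ Y ∷ p ∷ r ∷ E₁ ∷ E₂ ∷ F₁ ∷ F₂ ∷ []) ⟩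
    2 * (m * r * X + E₁) + (m * r * Y + E₂) + (m * p * X + F₁) + (m * p * Y + F₂) ∎
  heights : SlopeConditions X Y C p r →
            HeightConditions (m * (r * C)) (m * p * X + F₁) (m * r * X + E₁) (m * p * Y + F₂) (m * r * Y + E₂)
  heights (_ , inj₁ (left , right)) = inj₁ (
    (begin
      2 * (m * r * X + E₁) + (m * p * X + F₁)   ≡⟨ solve (m ∷ X ∷ p ∷ r ∷ E₁ ∷ F₁ ∷ []) ⟩
      m * (2 * r * X + p * X) + (E₁ + E₁ + F₁)  ≤⟨ <⇒≤ (scaled-< m left (small E₁≤ E₁≤ (≤-trans F₁≤E₁ E₁≤))) ⟩
      m * (r * C)                               ∎) ,
    (begin
      (m * r * X + E₁) + (m * r * Y + E₂) + (m * p * Y + F₂) ≡⟨ solve (m ∷ X ∷ Y ∷ p ∷ r ∷ E₁ ∷ E₂ ∷ F₂ ∷ []) ⟩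
      m * (r * X + r * Y + p * Y) + (E₁ + E₂ + F₂)           ≤⟨ <⇒≤ (scaled-< m right (small E₁≤ E₂≤ (≤-trans F₂≤E₂ E₂≤))) ⟩
      m * (r * C)                                            ∎))
  heights (_ , inj₂ (Y<X , left , right)) = inj₂ (
    (begin-strict
      m * r * Y + E₂       <⟨ +-monoʳ-< _ (≤-<-trans (≤-trans E₂≤ (m≤m+n (E₁ + E₂) _)) 3E<m) ⟩
      m * r * Y + m        ≤⟨ +-monoʳ-≤ _ (m≤m*n m r {{>-nonZero (≤-trans 1≤p p≤r)}}) ⟩
      m * r * Y + m * r    ≡⟨ solve (m ∷ r ∷ Y ∷ []) ⟩
      m * r * suc Y        ≤⟨ *-monoʳ-≤ (m * r) Y<X ⟩
      m * r * X            ≤⟨ m≤m+n _ E₁ ⟩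
      m * r * X + E₁       ∎) ,
    (begin
      2 * (m * r * X + E₁) + (m * p * X + F₁)   ≡⟨ solve (m ∷ X ∷ p ∷ r ∷ E₁ ∷ F₁ ∷ []) ⟩
      m * (2 * r * X + p * X) + (E₁ + E₁ + F₁)  ≤⟨ <⇒≤ (scaled-< m left (small E₁≤ E₁≤ (≤-trans F₁≤E₁ E₁≤))) ⟩
      m * (r * C + r * Y)                       ≡⟨ solve (m ∷ Y ∷ C ∷ r ∷ []) ⟩
      m * (r * C) + m * r * Y                   ≤⟨ +-monoʳ-≤ (m * (r * C)) (m≤m+n _ E₂) ⟩
      m * (r * C) + (m * r * Y + E₂)            ∎) ,
    (begin
      (m * r * X + E₁) + (m * p * Y + F₂)       ≡⟨ solve (m ∷ X ∷ Y ∷ p ∷ r ∷ E₁ ∷ F₂ ∷ []) ⟩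
      m * (r * X + p * Y) + (E₁ + F₂ + 0)       ≤⟨ <⇒≤ (scaled-< m right (small E₁≤ (≤-trans F₂≤E₂ E₂≤) z≤n)) ⟩
      m * (r * C)                               ∎))

unimodular-completion : ∀ {i j} → Coprime i j → 1 ≤ i → 1 ≤ j → ∃₂ λ s t → i * t ≡ 1 + j * s
unimodular-completion {i} {j} i⊥j 1≤i 1≤j with coprime-Bézout i⊥j
... | Bézout.+- x y eq = y , x , (begin
  i * x     ≡⟨ *-comm i x ⟩
  x * i     ≡⟨ eq ⟨
  1 + y * j ≡⟨ cong (1 +_) (*-comm y j) ⟩
  1 + j * y ∎)
  where open ≡-Reasoning
... | Bézout.-+ x y eq =
  i * (x + y) ∸ y , j * (x + y) ∸ x , +-cancelʳ-≡ (i * x) _ _ (begin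
    i * (j * (x + y) ∸ x) + i * x         ≡⟨ *-distribˡ-+ i _ x ⟨
    i * (j * (x + y) ∸ x + x)             ≡⟨ cong (i *_) (m∸n+n≡m (≤-trans (m≤m+n x y) (m≤n*m (x + y) j {{>-nonZero 1≤j}}))) ⟩
    i * (j * (x + y))                     ≡⟨ solve (i ∷ j ∷ x ∷ y ∷ []) ⟩
    j * (i * (x + y))                     ≡⟨ cong (j *_) (m∸n+n≡m (≤-trans (m≤n+m y x) (m≤n*m (x + y) i {{>-nonZero 1≤i}}))) ⟨
    j * (i * (x + y) ∸ y + y)             ≡⟨ *-distribˡ-+ j _ y ⟩
    j * (i * (x + y) ∸ y) + j * y         ≡⟨ cong (j * (i * (x + y) ∸ y) +_) (*-comm j y) ⟩
    j * (i * (x + y) ∸ y) + y * j         ≡⟨ cong (j * (i * (x + y) ∸ y) +_) eq ⟨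
    j * (i * (x + y) ∸ y) + (1 + x * i)   ≡⟨ +-assoc (j * _) 1 (x * i) ⟨
    j * (i * (x + y) ∸ y) + 1 + x * i     ≡⟨ cong₂ _+_ (+-comm _ 1) (*-comm x i) ⟩
    1 + j * (i * (x + y) ∸ y) + i * x     ∎)
  where open ≡-Reasoning

primitive-decomposition : ∀ {X Y} → 1 ≤ X → 1 ≤ Y →
                          ∃ λ d → ∃₂ λ i j → ∃₂ λ s t → X ≡ i * d × Y ≡ j * d × i * t ≡ 1 + j * s
primitive-decomposition {X} {Y} 1≤X 1≤Y =
  let s , t , det = unimodular-completion (coprime-/gcd X Y) (1≤quotient 1≤X (gcd[m,n]∣m X Y))
                                                            (1≤quotient 1≤Y (gcd[m,n]∣n X Y))
  in gcd X Y , X / gcd X Y , Y / gcd X Y , s , t ,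
     sym (m/n*n≡m (gcd[m,n]∣m X Y)) , sym (m/n*n≡m (gcd[m,n]∣n X Y)) , det
  where
  instance
    gcd≢0 : NonZero (gcd X Y)
    gcd≢0 = ≢-nonZero (gcd[m,n]≢0 X Y (inj₁ (m<n⇒n≢0 1≤X)))
  1≤quotient : ∀ {Z} → 1 ≤ Z → gcd X Y ∣ Z → 1 ≤ Z / gcd X Y
  1≤quotient {Z} 1≤Z g∣Z = n≢0⇒n>0 λ Z/g≡0 → m<n⇒n≢0 1≤Z (begin
    Z                   ≡⟨ m/n*n≡m g∣Z ⟨
    Z / gcd X Y * gcd X Y ≡⟨ cong (_* gcd X Y) Z/g≡0 ⟩
    0                   ∎)
    where open ≡-Reasoning

-- (q₁ q₂; a₁ a₂) = (r r′; p p′)·(A₁ A₂; i j) with A₁ = dm·i + s and A₂ = dm·j + t, a product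
-- of unimodular matrices; the choice of m makes the errors E₁, E₂ negligible.
family-consecutive : ∀ {p r p′ r′ i j s t d C} → p * r′ ≡ 1 + p′ * r → i * t ≡ 1 + j * s →
  1 ≤ p → p ≤ r → p′ ≤ r′ → 1 ≤ i * d → 1 ≤ j * d → SlopeConditions (i * d) (j * d) C p r →
  ∃ λ m → ∃₂ λ E₁ E₂ → E₁ < m × E₂ < m × InDQ (m * (r * C)) (m * r * (i * d) + E₁) (m * r * (j * d) + E₂)
family-consecutive {p} {r} {p′} {r′} {i} {j} {s} {t} {d} {C} det₁ det₂ 1≤p p≤r p′≤r′ 1≤X 1≤Y slope =
  m , E₁ , E₂ , E<m (m≤m+n E₁ E₂) , E<m (m≤n+m E₂ E₁) ,
  _ , _ , perturbed-consecutive m (i * d) (j * d) C p r E₁ E₂ (p * s + p′ * i) (p * t + p′ * j)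
            (unimodular m) 1≤p p≤r 1≤X 1≤Y
            (+-mono-≤ (*-monoˡ-≤ s p≤r) (*-monoˡ-≤ i p′≤r′)) (+-mono-≤ (*-monoˡ-≤ t p≤r) (*-monoˡ-≤ j p′≤r′))
            (m≤m+n 2 _) 3E<m slope
  where
  open ≡-Reasoning
  E₁ E₂ m : ℕ
  E₁ = r * s + r′ * i
  E₂ = r * t + r′ * j
  m = 2 + 3 * (E₁ + E₂)
  3E<m : 3 * (E₁ + E₂) < m
  3E<m = m<n+m (3 * (E₁ + E₂)) {2} (s≤s z≤n)
  E<m : ∀ {E} → E ≤ E₁ + E₂ → E < m
  E<m E≤ = ≤-<-trans (≤-trans E≤ (m≤m+n (E₁ + E₂) _)) 3E<m
  det : ∀ m → (j * (d * m) + t) * i ≡ 1 + (i * (d * m) + s) * j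
  det m = begin
    (j * (d * m) + t) * i     ≡⟨ solve (i ∷ j ∷ t ∷ d ∷ m ∷ []) ⟩
    j * (d * m) * i + i * t   ≡⟨ cong (j * (d * m) * i +_) det₂ ⟩
    j * (d * m) * i + (1 + j * s) ≡⟨ solve (i ∷ j ∷ s ∷ d ∷ m ∷ []) ⟩
    1 + (i * (d * m) + s) * j ∎
  unimodular : ∀ m → (m * p * (j * d) + (p * t + p′ * j)) * (m * r * (i * d) + E₁) ≡
                     1 + (m * p * (i * d) + (p * s + p′ * i)) * (m * r * (j * d) + E₂)
  unimodular m = begin
    (m * p * (j * d) + (p * t + p′ * j)) * (m * r * (i * d) + (r * s + r′ * i))
      ≡⟨ solve (p ∷ r ∷ p′ ∷ r′ ∷ i ∷ j ∷ s ∷ t ∷ d ∷ m ∷ []) ⟩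
    (p * (j * (d * m) + t) + p′ * j) * (r * (i * (d * m) + s) + r′ * i)
      ≡⟨ unimodular-product {p} {r} {p′} {r′} {i * (d * m) + s} {j * (d * m) + t} {i} {j} det₁ (det m) ⟩
    1 + (p * (i * (d * m) + s) + p′ * i) * (r * (j * (d * m) + t) + r′ * j)
      ≡⟨ solve (p ∷ r ∷ p′ ∷ r′ ∷ i ∷ j ∷ s ∷ t ∷ d ∷ m ∷ []) ⟩
    1 + (m * p * (i * d) + (p * s + p′ * i)) * (m * r * (j * d) + (r * t + r′ * j)) ∎

consecutive-near : ∀ {C X Y} → StrictRegion C X Y →
  ∃ λ m → ∃ λ r → ∃₂ λ E₁ E₂ → 1 ≤ r × E₁ < m × E₂ < m × InDQ (m * (r * C)) (m * r * X + E₁) (m * r * Y + E₂)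
consecutive-near {C} {X} {Y} region@(1≤X , 1≤Y , _) =
  let τ , δ , τ+δ≡X+Y , 1≤δ , slope = slope-exists region
      det₁ , p≤r , p′≤r′ = slope-matrix τ δ τ+δ≡X+Y 1≤δ
      d , i , j , s , t , X≡id , Y≡jd , det₂ = primitive-decomposition 1≤X 1≤Y
      m , E₁ , E₂ , E₁<m , E₂<m , pair = family-consecutive {(X + Y) * τ + 1} {r} {τ * δ + 1} {(X + Y) * δ + 1}
                                            {i} {j} {s} {t} {d} {C} det₁ det₂ (m≤n+m 1 _) p≤r p′≤r′
        (subst (1 ≤_) X≡id 1≤X) (subst (1 ≤_) Y≡jd 1≤Y)
        (subst₂ (λ X′ Y′ → SlopeConditions X′ Y′ C ((X + Y) * τ + 1) r) X≡id Y≡jd slope)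
  in m , r , E₁ , E₂ , ≤-trans (m≤n+m 1 _) p≤r , E₁<m , E₂<m ,
     subst₂ (λ X′ Y′ → InDQ (m * (r * C)) (m * r * X′ + E₁) (m * r * Y′ + E₂)) (sym X≡id) (sym Y≡jd) pair
  where
  r : ℕ
  r = (X + Y) * (X + Y)

-- Approximation

-- Moves (X₀/C₀, Y₀/C₀) towards the interior point (1/2, 1/3) of 𝒱 by the factor 1/(e + 1).
shrink : ∀ {C₀ X₀ Y₀} e → 1 ≤ C₀ → Region C₀ X₀ Y₀ →
         StrictRegion (6 * C₀ * suc e) (6 * X₀ * e + 3 * C₀) (6 * Y₀ * e + 2 * C₀)
shrink {C₀} {X₀} {Y₀} e 1≤C₀ (X₀≤C₀ , _ , C₀≤3X₀+2Y₀ , 2X₀≤C₀+Y₀ , upper) =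
  ≤-trans (pos 2) (m≤n+m (3 * C₀) (6 * X₀ * e)) , ≤-trans (pos 1) (m≤n+m (2 * C₀) (6 * Y₀ * e)) , X<C , C<3X+2Y , 2X<C+Y , sum-or-order upper
  where
  open ≤-Reasoning
  pos : ∀ k → 1 ≤ suc k * C₀
  pos k = ≤-trans 1≤C₀ (m≤n*m C₀ (suc k))
  X<C : 6 * X₀ * e + 3 * C₀ < 6 * C₀ * suc e
  X<C = begin-strict
    6 * X₀ * e + 3 * C₀              ≤⟨ +-monoˡ-≤ _ (*-monoˡ-≤ e (*-monoʳ-≤ 6 X₀≤C₀)) ⟩
    6 * C₀ * e + 3 * C₀              <⟨ m<m+n _ (pos 2) ⟩
    6 * C₀ * e + 3 * C₀ + 3 * C₀     ≡⟨ solve (C₀ ∷ e ∷ []) ⟩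
    6 * C₀ * suc e                   ∎
  C<3X+2Y : 6 * C₀ * suc e < 3 * (6 * X₀ * e + 3 * C₀) + 2 * (6 * Y₀ * e + 2 * C₀)
  C<3X+2Y = begin-strict
    6 * C₀ * suc e                   ≡⟨ solve (C₀ ∷ e ∷ []) ⟩
    6 * e * C₀ + 6 * C₀              <⟨ m<m+n _ (pos 6) ⟩
    6 * e * C₀ + 6 * C₀ + 7 * C₀     ≤⟨ +-monoˡ-≤ _ (+-monoˡ-≤ _ (*-monoʳ-≤ (6 * e) C₀≤3X₀+2Y₀)) ⟩
    6 * e * (3 * X₀ + 2 * Y₀) + 6 * C₀ + 7 * C₀ ≡⟨ solve (C₀ ∷ X₀ ∷ Y₀ ∷ e ∷ []) ⟩
    3 * (6 * X₀ * e + 3 * C₀) + 2 * (6 * Y₀ * e + 2 * C₀) ∎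
  2X<C+Y : 2 * (6 * X₀ * e + 3 * C₀) < 6 * C₀ * suc e + (6 * Y₀ * e + 2 * C₀)
  2X<C+Y = begin-strict
    2 * (6 * X₀ * e + 3 * C₀)        ≡⟨ solve (C₀ ∷ X₀ ∷ e ∷ []) ⟩
    6 * e * (2 * X₀) + 6 * C₀        ≤⟨ +-monoˡ-≤ _ (*-monoʳ-≤ (6 * e) 2X₀≤C₀+Y₀) ⟩
    6 * e * (C₀ + Y₀) + 6 * C₀       <⟨ m<m+n _ (pos 1) ⟩
    6 * e * (C₀ + Y₀) + 6 * C₀ + 2 * C₀ ≡⟨ solve (C₀ ∷ Y₀ ∷ e ∷ []) ⟩
    6 * C₀ * suc e + (6 * Y₀ * e + 2 * C₀) ∎
  sum-or-order : X₀ + Y₀ ≤ C₀ ⊎ Y₀ ≤ X₀ →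
                 (6 * X₀ * e + 3 * C₀) + (6 * Y₀ * e + 2 * C₀) < 6 * C₀ * suc e ⊎
                 6 * Y₀ * e + 2 * C₀ < 6 * X₀ * e + 3 * C₀
  sum-or-order (inj₁ X₀+Y₀≤C₀) = inj₁ (begin-strict
    (6 * X₀ * e + 3 * C₀) + (6 * Y₀ * e + 2 * C₀) ≡⟨ solve (C₀ ∷ X₀ ∷ Y₀ ∷ e ∷ []) ⟩
    6 * e * (X₀ + Y₀) + 5 * C₀       ≤⟨ +-monoˡ-≤ _ (*-monoʳ-≤ (6 * e) X₀+Y₀≤C₀) ⟩
    6 * e * C₀ + 5 * C₀              <⟨ m<m+n _ (pos 0) ⟩
    6 * e * C₀ + 5 * C₀ + 1 * C₀     ≡⟨ solve (C₀ ∷ e ∷ []) ⟩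
    6 * C₀ * suc e                   ∎)
  sum-or-order (inj₂ Y₀≤X₀) = inj₂ (begin-strict
    6 * Y₀ * e + 2 * C₀              ≤⟨ +-monoˡ-≤ _ (*-monoˡ-≤ e (*-monoʳ-≤ 6 Y₀≤X₀)) ⟩
    6 * X₀ * e + 2 * C₀              <⟨ m<m+n _ (pos 0) ⟩
    6 * X₀ * e + 2 * C₀ + 1 * C₀     ≡⟨ solve (C₀ ∷ X₀ ∷ e ∷ []) ⟩
    6 * X₀ * e + 3 * C₀              ∎)

-- |q/Q − X/C| < 1/E, with denominators cleared.
Close : ℕ → ℕ → ℕ → ℕ → ℕ → Set
Close E q Q X C = q * C * E < X * Q * E + Q * C × X * Q * E < q * C * E + Q * C

shrink-close : ∀ {X₀ C₀ m r E′} e c c′ → 1 ≤ c → 1 ≤ c′ → 1 ≤ C₀ → X₀ ≤ C₀ → 1 ≤ r → E′ < m →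
  Close (suc e) (m * r * ((c + c′) * X₀ * e + c * C₀) + E′) (m * (r * ((c + c′) * C₀ * suc e))) X₀ C₀
shrink-close {X₀} {C₀} {m} {r} {E′} e c c′ 1≤c 1≤c′ 1≤C₀ X₀≤C₀ 1≤r E′<m =
  (begin-strict
    (m * r * ((c + c′) * X₀ * e + c * C₀) + E′) * C₀ * suc e
      ≡⟨ *-assoc (m * r * ((c + c′) * X₀ * e + c * C₀) + E′) C₀ (suc e) ⟩
    (m * r * ((c + c′) * X₀ * e + c * C₀) + E′) * (C₀ * suc e)
      <⟨ *-monoˡ-< (C₀ * suc e) above ⟩
    ((c + c′) * X₀ * (m * r) * suc e + (c + c′) * (m * r) * C₀) * (C₀ * suc e)
      ≡⟨ solve (X₀ ∷ C₀ ∷ m ∷ r ∷ c ∷ c′ ∷ e ∷ []) ⟩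
    X₀ * (m * (r * ((c + c′) * C₀ * suc e))) * suc e + m * (r * ((c + c′) * C₀ * suc e)) * C₀ ∎) ,
  (begin-strict
    X₀ * (m * (r * ((c + c′) * C₀ * suc e))) * suc e
      ≡⟨ solve (X₀ ∷ C₀ ∷ m ∷ r ∷ c ∷ c′ ∷ e ∷ []) ⟩
    (c + c′) * X₀ * (m * r) * suc e * (C₀ * suc e)
      <⟨ *-monoˡ-< (C₀ * suc e) below ⟩
    (m * r * ((c + c′) * X₀ * e + c * C₀) + E′ + (c + c′) * (m * r) * C₀) * (C₀ * suc e)
      ≡⟨ solve (X₀ ∷ C₀ ∷ m ∷ r ∷ c ∷ c′ ∷ e ∷ E′ ∷ []) ⟩
    (m * r * ((c + c′) * X₀ * e + c * C₀) + E′) * C₀ * suc e + m * (r * ((c + c′) * C₀ * suc e)) * C₀ ∎)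
  where
  open ≤-Reasoning
  instance
    C₀[1+e]≢0 : NonZero (C₀ * suc e)
    C₀[1+e]≢0 = >-nonZero (*-mono-≤ 1≤C₀ (s≤s z≤n))
  E′<c′C₀mr : E′ < c′ * C₀ * (m * r)
  E′<c′C₀mr = <-≤-trans E′<m (≤-trans (m≤m*n m r {{>-nonZero 1≤r}})
                                     (m≤n*m (m * r) (c′ * C₀) {{>-nonZero (*-mono-≤ 1≤c′ 1≤C₀)}}))
  above : m * r * ((c + c′) * X₀ * e + c * C₀) + E′ < (c + c′) * X₀ * (m * r) * suc e + (c + c′) * (m * r) * C₀
  above = begin-strict
    m * r * ((c + c′) * X₀ * e + c * C₀) + E′                   <⟨ +-monoʳ-< _ E′<c′C₀mr ⟩
    m * r * ((c + c′) * X₀ * e + c * C₀) + c′ * C₀ * (m * r)    ≤⟨ m≤m+n _ _ ⟩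
    m * r * ((c + c′) * X₀ * e + c * C₀) + c′ * C₀ * (m * r) + (c + c′) * X₀ * (m * r)
      ≡⟨ solve (X₀ ∷ C₀ ∷ m ∷ r ∷ c ∷ c′ ∷ e ∷ []) ⟩
    (c + c′) * X₀ * (m * r) * suc e + (c + c′) * (m * r) * C₀   ∎
  below : (c + c′) * X₀ * (m * r) * suc e < m * r * ((c + c′) * X₀ * e + c * C₀) + E′ + (c + c′) * (m * r) * C₀
  below = begin-strict
    (c + c′) * X₀ * (m * r) * suc e
      ≡⟨ solve (X₀ ∷ m ∷ r ∷ c ∷ c′ ∷ e ∷ []) ⟩
    (c + c′) * X₀ * (m * r) * e + (c + c′) * (m * r) * X₀
      ≤⟨ +-monoʳ-≤ _ (*-monoʳ-≤ ((c + c′) * (m * r)) X₀≤C₀) ⟩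
    (c + c′) * X₀ * (m * r) * e + (c + c′) * (m * r) * C₀
      <⟨ m<m+n _ (*-mono-≤ (*-mono-≤ 1≤c 1≤C₀) (*-mono-≤ (≤-trans (s≤s z≤n) E′<m) 1≤r)) ⟩
    (c + c′) * X₀ * (m * r) * e + (c + c′) * (m * r) * C₀ + c * C₀ * (m * r)
      ≡⟨ solve (X₀ ∷ C₀ ∷ m ∷ r ∷ c ∷ c′ ∷ e ∷ []) ⟩
    m * r * ((c + c′) * X₀ * e + c * C₀) + (c + c′) * (m * r) * C₀
      ≤⟨ +-monoˡ-≤ ((c + c′) * (m * r) * C₀) (m≤m+n (m * r * ((c + c′) * X₀ * e + c * C₀)) E′) ⟩
    m * r * ((c + c′) * X₀ * e + c * C₀) + E′ + (c + c′) * (m * r) * C₀ ∎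

dense-ℕ : ∀ {C₀ X₀ Y₀} e → 1 ≤ C₀ → Region C₀ X₀ Y₀ →
          ∃ λ Q → ∃₂ λ q₁ q₂ → 3 ≤ Q × InDQ Q q₁ q₂ × Close (suc e) q₁ Q X₀ C₀ × Close (suc e) q₂ Q Y₀ C₀
dense-ℕ {C₀} {X₀} {Y₀} e 1≤C₀ region@(X₀≤C₀ , Y₀≤C₀ , _) =
  let m , r , E₁ , E₂ , 1≤r , E₁<m , E₂<m , pair = consecutive-near (shrink e 1≤C₀ region)
  in m * (r * (6 * C₀ * suc e)) , m * r * (6 * X₀ * e + 3 * C₀) + E₁ , m * r * (6 * Y₀ * e + 2 * C₀) + E₂ ,
     *-mono-≤ (≤-trans (s≤s z≤n) E₁<m) (*-mono-≤ 1≤r (*-mono-≤ (*-mono-≤ (m≤m+n 3 3) 1≤C₀) (s≤s z≤n))) ,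
     pair ,
     shrink-close e 3 3 (s≤s z≤n) (s≤s z≤n) 1≤C₀ X₀≤C₀ 1≤r E₁<m ,
     shrink-close e 2 4 (s≤s z≤n) (s≤s z≤n) 1≤C₀ Y₀≤C₀ 1≤r E₂<m

-- Translation to ℚ

ℚ-ring : AlmostCommutativeRing 0ℓ 0ℓ
ℚ-ring = fromCommutativeRing ℚ.+-*-commutativeRing (λ p → dec⇒maybe (0ℚ ℚ.≟ p))

-- In constructor form rather than + n / 1, so that unification can see through ι.
ι : ℕ → ℚ
ι n = mkℚ (ℤ.+ n) 0 (coprime-sym (1-coprimeTo n))

ι-+ : ∀ m n → ι (m + n) ≡ ι m ℚ.+ ι n
ι-+ m n = ℚ.toℚᵘ-injective (begin
  mkℚᵘ (ℤ.+ (m + n)) 0            ≈⟨ *≡* (trans (ℤ.*-identityʳ _) (trans (ℤ.pos-+ m n) (sym (trans (ℤ.*-identityʳ _)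
                                         (cong₂ ℤ._+_ (ℤ.*-identityʳ (ℤ.+ m)) (ℤ.*-identityʳ (ℤ.+ n))))))) ⟩
  mkℚᵘ (ℤ.+ m) 0 ℚᵘ.+ mkℚᵘ (ℤ.+ n) 0  ≈⟨ ℚ.toℚᵘ-homo-+ (ι m) (ι n) ⟨
  toℚᵘ (ι m ℚ.+ ι n)              ∎)
  where open ℚᵘ.≃-Reasoning

ι-* : ∀ m n → ι (m * n) ≡ ι m ℚ.* ι n
ι-* m n = ℚ.toℚᵘ-injective (begin
  mkℚᵘ (ℤ.+ (m * n)) 0              ≈⟨ *≡* (trans (ℤ.*-identityʳ _) (trans (ℤ.pos-* m n) (sym (ℤ.*-identityʳ _)))) ⟩
  mkℚᵘ (ℤ.+ m) 0 ℚᵘ.* mkℚᵘ (ℤ.+ n) 0  ≈⟨ ℚ.toℚᵘ-homo-* (ι m) (ι n) ⟨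
  toℚᵘ (ι m ℚ.* ι n)              ∎)
  where open ℚᵘ.≃-Reasoning

ι-mono-≤ : ∀ {m n} → m ≤ n → ι m ℚ.≤ ι n
ι-mono-≤ {m} {n} m≤n = *≤* (subst₂ ℤ._≤_ (sym (ℤ.*-identityʳ (ℤ.+ m))) (sym (ℤ.*-identityʳ (ℤ.+ n))) (ℤ.+≤+ m≤n))

ι-mono-< : ∀ {m n} → m < n → ι m ℚ.< ι n
ι-mono-< {m} {n} m<n = *<* (subst₂ ℤ._<_ (sym (ℤ.*-identityʳ (ℤ.+ m))) (sym (ℤ.*-identityʳ (ℤ.+ n))) (ℤ.+<+ m<n))

ι-positive : ∀ {n} → 1 ≤ n → ℚ.Positive (ι n)
ι-positive 1≤n = ℚ.positive (ι-mono-< 1≤n)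

*-denominator : ∀ p n d → toℚᵘ p ℚᵘ.≃ mkℚᵘ (ℤ.+ n) d → p ℚ.* ι (suc d) ≡ ι n
*-denominator p n d p≃n/d = ℚ.toℚᵘ-injective (begin
  toℚᵘ (p ℚ.* ι (suc d))               ≈⟨ ℚ.toℚᵘ-homo-* p (ι (suc d)) ⟩
  toℚᵘ p ℚᵘ.* mkℚᵘ (ℤ.+ suc d) 0         ≈⟨ ℚᵘ.*-congʳ p≃n/d ⟩
  mkℚᵘ (ℤ.+ n) d ℚᵘ.* mkℚᵘ (ℤ.+ suc d) 0   ≈⟨ *≡* (trans (ℤ.*-identityʳ _) (cong (ℤ.+ n ℤ.*_) (cong ℤ.+_ (sym (*-identityʳ (suc d)))))) ⟩
  mkℚᵘ (ℤ.+ n) 0                         ∎)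
  where open ℚᵘ.≃-Reasoning

/ℕ-*-denominator : ∀ q {Q} → 1 ≤ Q → (q /ℕ Q) ℚ.* ι Q ≡ ι q
/ℕ-*-denominator q {suc Q} _ = *-denominator (ℤ.+ q ℚ./ suc Q) q Q (ℚ.toℚᵘ-fromℚᵘ (mkℚᵘ (ℤ.+ q) Q))

+-cancelʳ-≤ℚ : ∀ u v w → u ℚ.+ w ℚ.≤ v ℚ.+ w → u ℚ.≤ v
+-cancelʳ-≤ℚ u v w le = subst₂ ℚ._≤_ (ℚ-+-∸ u w) (ℚ-+-∸ v w) (ℚ.+-monoˡ-≤ (ℚ.- w) le)
  where
  ℚ-+-∸ : ∀ z w → z ℚ.+ w ℚ.+ ℚ.- w ≡ z
  ℚ-+-∸ z w = solve-ring (z ∷ w ∷ []) ℚ-ring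

+-cancelʳ-<ℚ : ∀ u v w → u ℚ.+ w ℚ.< v ℚ.+ w → u ℚ.< v
+-cancelʳ-<ℚ u v w lt = subst₂ ℚ._<_ (ℚ-+-∸ u w) (ℚ-+-∸ v w) (ℚ.+-monoˡ-< (ℚ.- w) lt)
  where
  ℚ-+-∸ : ∀ z w → z ℚ.+ w ℚ.+ ℚ.- w ≡ z
  ℚ-+-∸ z w = solve-ring (z ∷ w ∷ []) ℚ-ring

-- p·K + a = b, as a record so that p, K, a and b can be inferred from it.
record Scaled (K p : ℚ) (a b : ℕ) : Set where
  constructor scaled
  field scaled-eq : p ℚ.* K ℚ.+ ι a ≡ ι b

common-offset : ∀ {p r K a b c d} → Scaled K p a b → Scaled K r c d →
                p ℚ.* K ℚ.+ (ι a ℚ.+ ι c) ≡ ι (b + c) × r ℚ.* K ℚ.+ (ι a ℚ.+ ι c) ≡ ι (d + a)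
common-offset {p} {r} {K} {a} {b} {c} {d} (scaled pK) (scaled rK) = left , right
  where
  open ≡-Reasoning
  left : p ℚ.* K ℚ.+ (ι a ℚ.+ ι c) ≡ ι (b + c)
  left = begin
    p ℚ.* K ℚ.+ (ι a ℚ.+ ι c) ≡⟨ ℚ.+-assoc (p ℚ.* K) (ι a) (ι c) ⟨
    p ℚ.* K ℚ.+ ι a ℚ.+ ι c   ≡⟨ cong (ℚ._+ ι c) pK ⟩
    ι b ℚ.+ ι c               ≡⟨ ι-+ b c ⟨
    ι (b + c)                 ∎
  right : r ℚ.* K ℚ.+ (ι a ℚ.+ ι c) ≡ ι (d + a)
  right = begin
    r ℚ.* K ℚ.+ (ι a ℚ.+ ι c) ≡⟨ cong (r ℚ.* K ℚ.+_) (ℚ.+-comm (ι a) (ι c)) ⟩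
    r ℚ.* K ℚ.+ (ι c ℚ.+ ι a) ≡⟨ ℚ.+-assoc (r ℚ.* K) (ι c) (ι a) ⟨
    r ℚ.* K ℚ.+ ι c ℚ.+ ι a   ≡⟨ cong (ℚ._+ ι a) rK ⟩
    ι d ℚ.+ ι a               ≡⟨ ι-+ d a ⟨
    ι (d + a)                 ∎

<-by-scaling : ∀ {p r K a b c d} .{{_ : ℚ.Positive K}} → Scaled K p a b → Scaled K r c d → b + c < d + a → p ℚ.< r
<-by-scaling {p} {r} {K} {a} {b} {c} {d} pK rK lt =
  let left , right = common-offset pK rK in
  ℚ.*-cancelʳ-<-nonNeg K {{ℚ.pos⇒nonNeg K}}
    (+-cancelʳ-<ℚ (p ℚ.* K) (r ℚ.* K) (ι a ℚ.+ ι c) (subst₂ ℚ._<_ (sym left) (sym right) (ι-mono-< lt)))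

≤-by-scaling : ∀ {p r K a b c d} .{{_ : ℚ.Positive K}} → Scaled K p a b → Scaled K r c d → p ℚ.≤ r ⇔ b + c ≤ d + a
≤-by-scaling {p} {r} {K} {a} {b} {c} {d} pK rK = mk⇔
  (λ p≤r → ≮⇒≥ λ d+a<b+c → ℚ.<-irrefl refl (ℚ.≤-<-trans p≤r (<-by-scaling rK pK d+a<b+c)))
  (λ b+c≤d+a → let left , right = common-offset pK rK in
    ℚ.*-cancelʳ-≤-pos K
      (+-cancelʳ-≤ℚ (p ℚ.* K) (r ℚ.* K) (ι a ℚ.+ ι c) (subst₂ ℚ._≤_ (sym left) (sym right) (ι-mono-≤ b+c≤d+a))))

module _ {x y : ℚ} {N a b : ℕ} (1≤N : 1 ≤ N) (xN≡a : x ℚ.* ι N ≡ ι a) (yN≡b : y ℚ.* ι N ≡ ι b) where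

  private
    instance
      N-positive : ℚ.Positive (ι N)
      N-positive = ι-positive 1≤N
      2N-positive : ℚ.Positive (ι 2 ℚ.* ι N)
      2N-positive = subst ℚ.Positive (ι-* 2 N) (ι-positive (*-mono-≤ {1} {2} (s≤s z≤n) 1≤N))

    lower₁ lower₂ : ℚ
    lower₁ = (1ℚ - ι 3 ℚ.* x) ℚ.* ℚ.½
    lower₂ = ι 2 ℚ.* x - 1ℚ

    offset-0 : ∀ p {n} → p ℚ.* ι N ≡ ι n → Scaled (ι N) p 0 n
    offset-0 p eq = scaled (trans (ℚ.+-identityʳ (p ℚ.* ι N)) eq)

    0≡ : Scaled (ι N) 0ℚ 0 0
    0≡ = offset-0 0ℚ (ℚ.*-zeroˡ (ι N))

    1≡ : Scaled (ι N) 1ℚ 0 N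
    1≡ = offset-0 1ℚ (ℚ.*-identityˡ (ι N))

    y2N≡2b : Scaled (ι 2 ℚ.* ι N) y 0 (2 * b)
    y2N≡2b = scaled $ begin
      y ℚ.* (ι 2 ℚ.* ι N) ℚ.+ ι 0 ≡⟨ identity y (ι N) ⟩
      ι 2 ℚ.* (y ℚ.* ι N)         ≡⟨ cong (ι 2 ℚ.*_) yN≡b ⟩
      ι 2 ℚ.* ι b                 ≡⟨ ι-* 2 b ⟨
      ι (2 * b)                   ∎
      where
      open ≡-Reasoning
      identity : ∀ y n → y ℚ.* (ι 2 ℚ.* n) ℚ.+ ι 0 ≡ ι 2 ℚ.* (y ℚ.* n)
      identity y n = solve-ring (y ∷ n ∷ []) ℚ-ring

    lower₁≡ : Scaled (ι 2 ℚ.* ι N) lower₁ (3 * a) N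
    lower₁≡ = scaled $ begin
      (1ℚ - ι 3 ℚ.* x) ℚ.* ℚ.½ ℚ.* (ι 2 ℚ.* ι N) ℚ.+ ι (3 * a)   ≡⟨ cong (λ z → (1ℚ - ι 3 ℚ.* x) ℚ.* ℚ.½ ℚ.* (ι 2 ℚ.* ι N) ℚ.+ z) (trans (ι-* 3 a) (cong (ι 3 ℚ.*_) (sym xN≡a))) ⟩
      (1ℚ - ι 3 ℚ.* x) ℚ.* ℚ.½ ℚ.* (ι 2 ℚ.* ι N) ℚ.+ ι 3 ℚ.* (x ℚ.* ι N) ≡⟨ identity x (ι N) ⟩
      ι N ∎
      where
      open ≡-Reasoning
      identity : ∀ x n → (1ℚ - ι 3 ℚ.* x) ℚ.* ℚ.½ ℚ.* (ι 2 ℚ.* n) ℚ.+ ι 3 ℚ.* (x ℚ.* n) ≡ n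
      identity x n = solve-ring (x ∷ n ∷ []) ℚ-ring

    lower₂≡ : Scaled (ι N) lower₂ N (2 * a)
    lower₂≡ = scaled $ begin
      (ι 2 ℚ.* x - 1ℚ) ℚ.* ι N ℚ.+ ι N ≡⟨ identity x (ι N) ⟩
      ι 2 ℚ.* (x ℚ.* ι N)             ≡⟨ cong (ι 2 ℚ.*_) xN≡a ⟩
      ι 2 ℚ.* ι a                     ≡⟨ ι-* 2 a ⟨
      ι (2 * a)                       ∎
      where
      open ≡-Reasoning
      identity : ∀ x n → (ι 2 ℚ.* x - 1ℚ) ℚ.* n ℚ.+ n ≡ ι 2 ℚ.* (x ℚ.* n)
      identity x n = solve-ring (x ∷ n ∷ []) ℚ-ring

    upper₁≡ : Scaled (ι N) (1ℚ - x) a N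
    upper₁≡ = scaled $ begin
      (1ℚ - x) ℚ.* ι N ℚ.+ ι a        ≡⟨ cong ((1ℚ - x) ℚ.* ι N ℚ.+_) xN≡a ⟨
      (1ℚ - x) ℚ.* ι N ℚ.+ x ℚ.* ι N  ≡⟨ identity x (ι N) ⟩
      ι N                             ∎
      where
      open ≡-Reasoning
      identity : ∀ x n → (1ℚ - x) ℚ.* n ℚ.+ x ℚ.* n ≡ n
      identity x n = solve-ring (x ∷ n ∷ []) ℚ-ring

    drop-+0 : ∀ {m n} → m + 0 ≤ n + 0 → m ≤ n
    drop-+0 {m} {n} = subst₂ _≤_ (+-identityʳ m) (+-identityʳ n)

    add-+0 : ∀ {m n} → m ≤ n → m + 0 ≤ n + 0
    add-+0 {m} {n} = subst₂ _≤_ (sym (+-identityʳ m)) (sym (+-identityʳ n))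

    open Equivalence

  Region⇔InV : Region N a b ⇔ InV x y
  Region⇔InV = mk⇔ Region⇒InV InV⇒Region
    where
    Region⇒InV : Region N a b → InV x y
    Region⇒InV (a≤N , b≤N , N≤3a+2b , 2a≤N+b , upper) =
      from (≤-by-scaling 0≡ (offset-0 x xN≡a)) z≤n ,
      from (≤-by-scaling (offset-0 x xN≡a) 1≡) (add-+0 a≤N) ,
      from (≤-by-scaling 0≡ (offset-0 y yN≡b)) z≤n ,
      from (≤-by-scaling (offset-0 y yN≡b) 1≡) (add-+0 b≤N) ,
      ℚ.⊔-lub (from (≤-by-scaling lower₁≡ y2N≡2b) (subst (_≤ 2 * b + 3 * a) (sym (+-identityʳ N)) (subst (N ≤_) (+-comm (3 * a) (2 * b)) N≤3a+2b)))
              (from (≤-by-scaling lower₂≡ (offset-0 y yN≡b)) (subst₂ _≤_ (sym (+-identityʳ (2 * a))) (+-comm N b) 2a≤N+b)) ,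
      below-max upper
      where
      below-max : a + b ≤ N ⊎ b ≤ a → y ℚ.≤ (1ℚ - x) ⊔ x
      below-max (inj₁ a+b≤N) = ℚ.p≤q⇒p≤q⊔r x (from (≤-by-scaling (offset-0 y yN≡b) upper₁≡) (subst₂ _≤_ (+-comm a b) (sym (+-identityʳ N)) a+b≤N))
      below-max (inj₂ b≤a) = ℚ.p≤q⇒p≤r⊔q (1ℚ - x) (from (≤-by-scaling (offset-0 y yN≡b) (offset-0 x xN≡a)) (add-+0 b≤a))
    InV⇒Region : InV x y → Region N a b
    InV⇒Region (_ , x≤1 , _ , y≤1 , lower , upper) =
      drop-+0 (to (≤-by-scaling (offset-0 x xN≡a) 1≡) x≤1) ,
      drop-+0 (to (≤-by-scaling (offset-0 y yN≡b) 1≡) y≤1) ,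
      subst₂ _≤_ (+-identityʳ N) (+-comm (2 * b) (3 * a)) (to (≤-by-scaling lower₁≡ y2N≡2b) (ℚ.p⊔q≤r⇒p≤r lower₁ lower₂ lower)) ,
      subst₂ _≤_ (+-identityʳ (2 * a)) (+-comm b N) (to (≤-by-scaling lower₂≡ (offset-0 y yN≡b)) (ℚ.p⊔q≤r⇒q≤r lower₁ lower₂ lower)) ,
      below-max (ℚ.⊔-sel (1ℚ - x) x)
      where
      below-max : (1ℚ - x) ⊔ x ≡ 1ℚ - x ⊎ (1ℚ - x) ⊔ x ≡ x → a + b ≤ N ⊎ b ≤ a
      below-max (inj₁ max≡1-x) = inj₁ (subst₂ _≤_ (+-comm b a) (+-identityʳ N)
        (to (≤-by-scaling (offset-0 y yN≡b) upper₁≡) (subst (y ℚ.≤_) max≡1-x upper)))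
      below-max (inj₂ max≡x) = inj₂ (drop-+0 (to (≤-by-scaling (offset-0 y yN≡b) (offset-0 x xN≡a)) (subst (y ℚ.≤_) max≡x upper)))

common-denominator : ∀ x y → 0ℚ ℚ.≤ x → 0ℚ ℚ.≤ y →
                     ∃ λ C → ∃₂ λ X Y → 1 ≤ C × x ℚ.* ι C ≡ ι X × y ℚ.* ι C ≡ ι Y
common-denominator (mkℚ -[1+ _ ] _ _) _ (*≤* ()) _
common-denominator (mkℚ (ℤ.+ _) _ _) (mkℚ -[1+ _ ] _ _) _ (*≤* ())
common-denominator x@(mkℚ (ℤ.+ X) dx _) y@(mkℚ (ℤ.+ Y) dy _) _ _ =
  suc dx * suc dy , X * suc dy , Y * suc dx , *-mono-≤ {1} {suc dx} {1} {suc dy} (s≤s z≤n) (s≤s z≤n) ,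
  (begin
    x ℚ.* ι (suc dx * suc dy)            ≡⟨ cong (x ℚ.*_) (ι-* (suc dx) (suc dy)) ⟩
    x ℚ.* (ι (suc dx) ℚ.* ι (suc dy))    ≡⟨ ℚ.*-assoc x (ι (suc dx)) (ι (suc dy)) ⟨
    x ℚ.* ι (suc dx) ℚ.* ι (suc dy)      ≡⟨ cong (ℚ._* ι (suc dy)) (*-denominator x X dx ℚᵘ.≃-refl) ⟩
    ι X ℚ.* ι (suc dy)                   ≡⟨ ι-* X (suc dy) ⟨
    ι (X * suc dy)                       ∎) ,
  (begin
    y ℚ.* ι (suc dx * suc dy)            ≡⟨ cong (λ z → y ℚ.* ι z) (*-comm (suc dx) (suc dy)) ⟩
    y ℚ.* ι (suc dy * suc dx)            ≡⟨ cong (y ℚ.*_) (ι-* (suc dy) (suc dx)) ⟩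
    y ℚ.* (ι (suc dy) ℚ.* ι (suc dx))    ≡⟨ ℚ.*-assoc y (ι (suc dy)) (ι (suc dx)) ⟨
    y ℚ.* ι (suc dy) ℚ.* ι (suc dx)      ≡⟨ cong (ℚ._* ι (suc dx)) (*-denominator y Y dy ℚᵘ.≃-refl) ⟩
    ι Y ℚ.* ι (suc dx)                   ≡⟨ ι-* Y (suc dx) ⟨
    ι (Y * suc dx)                       ∎)
  where open ≡-Reasoning

positive-fraction : ∀ ε → 0ℚ ℚ.< ε → ∃₂ λ n e → ε ℚ.* ι (suc e) ≡ ι (suc n)
positive-fraction (mkℚ (ℤ.+ zero) _ _) (*<* (ℤ.+<+ ()))
positive-fraction (mkℚ -[1+ _ ] _ _) (*<* ())
positive-fraction ε@(mkℚ (ℤ.+ suc n) e _) _ = n , e , *-denominator ε (suc n) e ℚᵘ.≃-refl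

ι-*₃ : ∀ a b c → ι (a * b * c) ≡ ι a ℚ.* ι b ℚ.* ι c
ι-*₃ a b c = trans (ι-* (a * b) c) (cong (ℚ._* ι c) (ι-* a b))

∣-∣<-from : ∀ {p ε} → p ℚ.< ε → ℚ.- p ℚ.< ε → ∣ p ∣ ℚ.< ε
∣-∣<-from {p} {ε} p<ε -p<ε with ℚ.∣p∣≡p∨∣p∣≡-p p
... | inj₁ ∣p∣≡p  = subst (ℚ._< ε) (sym ∣p∣≡p) p<ε
... | inj₂ ∣p∣≡-p = subst (ℚ._< ε) (sym ∣p∣≡-p) -p<ε

Close⇒∣-∣< : ∀ {u x ε Q C E q X n} → 1 ≤ Q → 1 ≤ C → 1 ≤ E → 1 ≤ n →
             u ℚ.* ι Q ≡ ι q → x ℚ.* ι C ≡ ι X → ε ℚ.* ι E ≡ ι n → Close E q Q X C → ∣ u - x ∣ ℚ.< ε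
Close⇒∣-∣< {u} {x} {ε} {Q} {C} {E} {q} {X} {n} 1≤Q 1≤C 1≤E 1≤n uQ≡q xC≡X εE≡n (above , below) =
  ∣-∣<-from (<-by-scaling u-x-scaled ε-scaled (within above)) (<-by-scaling x-u-scaled ε-scaled (within below))
  where
  instance
    QCE-positive : ℚ.Positive (ι (Q * C * E))
    QCE-positive = ι-positive (*-mono-≤ {1} {Q * C} (*-mono-≤ {1} {Q} 1≤Q 1≤C) 1≤E)
  within : ∀ {s t} → s < t + Q * C → s + 0 < n * Q * C + t
  within {s} {t} s<t+QC = begin-strict
    s + 0           ≡⟨ +-identityʳ s ⟩
    s               <⟨ s<t+QC ⟩
    t + Q * C       ≤⟨ +-monoʳ-≤ t (*-monoˡ-≤ C (m≤n*m Q n {{>-nonZero 1≤n}})) ⟩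
    t + n * Q * C   ≡⟨ +-comm t _ ⟩
    n * Q * C + t   ∎
    where open ≤-Reasoning
  ε-scaled : Scaled (ι (Q * C * E)) ε 0 (n * Q * C)
  ε-scaled = scaled (begin
    ε ℚ.* ι (Q * C * E) ℚ.+ ι 0           ≡⟨ cong (λ k → ε ℚ.* k ℚ.+ ι 0) (ι-*₃ Q C E) ⟩
    ε ℚ.* (ι Q ℚ.* ι C ℚ.* ι E) ℚ.+ ι 0   ≡⟨ identity ε (ι Q) (ι C) (ι E) ⟩
    ε ℚ.* ι E ℚ.* ι Q ℚ.* ι C             ≡⟨ cong (λ t → t ℚ.* ι Q ℚ.* ι C) εE≡n ⟩
    ι n ℚ.* ι Q ℚ.* ι C                   ≡⟨ ι-*₃ n Q C ⟨
    ι (n * Q * C)                         ∎)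
    where
    open ≡-Reasoning
    identity : ∀ ε Q C E → ε ℚ.* (Q ℚ.* C ℚ.* E) ℚ.+ ι 0 ≡ ε ℚ.* E ℚ.* Q ℚ.* C
    identity ε Q C E = solve-ring (ε ∷ Q ∷ C ∷ E ∷ []) ℚ-ring
  u-x-scaled : Scaled (ι (Q * C * E)) (u - x) (X * Q * E) (q * C * E)
  u-x-scaled = scaled (begin
    (u - x) ℚ.* ι (Q * C * E) ℚ.+ ι (X * Q * E)
      ≡⟨ cong₂ (λ k t → (u - x) ℚ.* k ℚ.+ t) (ι-*₃ Q C E) (ι-*₃ X Q E) ⟩
    (u - x) ℚ.* (ι Q ℚ.* ι C ℚ.* ι E) ℚ.+ ι X ℚ.* ι Q ℚ.* ι E
      ≡⟨ cong (λ t → (u - x) ℚ.* (ι Q ℚ.* ι C ℚ.* ι E) ℚ.+ t ℚ.* ι Q ℚ.* ι E) xC≡X ⟨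
    (u - x) ℚ.* (ι Q ℚ.* ι C ℚ.* ι E) ℚ.+ x ℚ.* ι C ℚ.* ι Q ℚ.* ι E
      ≡⟨ identity u x (ι Q) (ι C) (ι E) ⟩
    u ℚ.* ι Q ℚ.* ι C ℚ.* ι E
      ≡⟨ cong (λ t → t ℚ.* ι C ℚ.* ι E) uQ≡q ⟩
    ι q ℚ.* ι C ℚ.* ι E
      ≡⟨ ι-*₃ q C E ⟨
    ι (q * C * E) ∎)
    where
    open ≡-Reasoning
    identity : ∀ u x Q C E → (u - x) ℚ.* (Q ℚ.* C ℚ.* E) ℚ.+ x ℚ.* C ℚ.* Q ℚ.* E ≡ u ℚ.* Q ℚ.* C ℚ.* E
    identity u x Q C E = solve-ring (u ∷ x ∷ Q ∷ C ∷ E ∷ []) ℚ-ring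
  x-u-scaled : Scaled (ι (Q * C * E)) (ℚ.- (u - x)) (q * C * E) (X * Q * E)
  x-u-scaled = scaled (begin
    ℚ.- (u - x) ℚ.* ι (Q * C * E) ℚ.+ ι (q * C * E)
      ≡⟨ cong₂ (λ k t → ℚ.- (u - x) ℚ.* k ℚ.+ t) (ι-*₃ Q C E) (ι-*₃ q C E) ⟩
    ℚ.- (u - x) ℚ.* (ι Q ℚ.* ι C ℚ.* ι E) ℚ.+ ι q ℚ.* ι C ℚ.* ι E
      ≡⟨ cong (λ t → ℚ.- (u - x) ℚ.* (ι Q ℚ.* ι C ℚ.* ι E) ℚ.+ t ℚ.* ι C ℚ.* ι E) uQ≡q ⟨
    ℚ.- (u - x) ℚ.* (ι Q ℚ.* ι C ℚ.* ι E) ℚ.+ u ℚ.* ι Q ℚ.* ι C ℚ.* ι E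
      ≡⟨ identity u x (ι Q) (ι C) (ι E) ⟩
    x ℚ.* ι C ℚ.* ι Q ℚ.* ι E
      ≡⟨ cong (λ t → t ℚ.* ι Q ℚ.* ι E) xC≡X ⟩
    ι X ℚ.* ι Q ℚ.* ι E
      ≡⟨ ι-*₃ X Q E ⟨
    ι (X * Q * E) ∎)
    where
    open ≡-Reasoning
    identity : ∀ u x Q C E → ℚ.- (u - x) ℚ.* (Q ℚ.* C ℚ.* E) ℚ.+ u ℚ.* Q ℚ.* C ℚ.* E ≡ x ℚ.* C ℚ.* Q ℚ.* E
    identity u x Q C E = solve-ring (u ∷ x ∷ Q ∷ C ∷ E ∷ []) ℚ-ring

theorem1 : (∀ (Q q₁ q₂ : ℕ) → 3 ≤ Q → InDQ Q q₁ q₂ → InV (q₁ /ℕ Q) (q₂ /ℕ Q))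
           × (∀ (x y ε : ℚ) → InV x y → 0ℚ ℚ.< ε →
                ∃ λ Q → ∃ λ q₁ → ∃ λ q₂ → (3 ≤ Q) × InDQ Q q₁ q₂
                  × (∣ (q₁ /ℕ Q) - x ∣ ℚ.< ε) × (∣ (q₂ /ℕ Q) - y ∣ ℚ.< ε))
theorem1 = necessity , density
  where
  necessity : ∀ (Q q₁ q₂ : ℕ) → 3 ≤ Q → InDQ Q q₁ q₂ → InV (q₁ /ℕ Q) (q₂ /ℕ Q)
  necessity Q q₁ q₂ 3≤Q (_ , _ , consecutive) =
    let 1≤Q = ≤-trans (s≤s z≤n) 3≤Q in
    Equivalence.to (Region⇔InV 1≤Q (/ℕ-*-denominator q₁ 1≤Q) (/ℕ-*-denominator q₂ 1≤Q))
                   (consecutive⇒Region consecutive)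
  density : ∀ (x y ε : ℚ) → InV x y → 0ℚ ℚ.< ε →
            ∃ λ Q → ∃ λ q₁ → ∃ λ q₂ → (3 ≤ Q) × InDQ Q q₁ q₂
              × (∣ (q₁ /ℕ Q) - x ∣ ℚ.< ε) × (∣ (q₂ /ℕ Q) - y ∣ ℚ.< ε)
  density x y ε xy∈𝒱@(0≤x , _ , 0≤y , _) 0<ε =
    let C , X , Y , 1≤C , xC≡X , yC≡Y = common-denominator x y 0≤x 0≤y
        n , e , εe≡n = positive-fraction ε 0<ε
        Q , q₁ , q₂ , 3≤Q , pair , close₁ , close₂ =
          dense-ℕ e 1≤C (Equivalence.from (Region⇔InV 1≤C xC≡X yC≡Y) xy∈𝒱)
        1≤Q = ≤-trans (s≤s z≤n) 3≤Q
    in Q , q₁ , q₂ , 3≤Q , pair ,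
       Close⇒∣-∣< {q₁ /ℕ Q} {x} {ε} 1≤Q 1≤C (s≤s z≤n) (s≤s z≤n) (/ℕ-*-denominator q₁ 1≤Q) xC≡X εe≡n close₁ ,
       Close⇒∣-∣< {q₂ /ℕ Q} {y} {ε} 1≤Q 1≤C (s≤s z≤n) (s≤s z≤n) (/ℕ-*-denominator q₂ 1≤Q) yC≡Y εe≡n close₂
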